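{- For $n\ge 1$ let $a_n = |S_n^2(132,213)|$. Then $a_1=1$ and $a_{n+1} = a_n + 3\cdot 2^{n-1} + 2(n-1)$ for all $n\ge 1$.
   Context: A $3$-permutation of size $n$ is an ordered pair $(\sigma,\sigma')$ of permutations of $[n]=\{1,\dots,n\}$. A (classical) permutation $\tau\in S_n$ contains a pattern $\pi\in S_k$ if there are indices $c_1<\dots<c_k$ such that $\tau(c_1)\cdots\tau(c_k)$ is order-isomorphic to $\pi$, and avoids $\pi$ otherwise. A $3$-permutation $(\sigma,\sigma')$ avoids a pattern $\pi\in S_k$ if each of the three permutations $\sigma$, $\sigma'$, and $\sigma'\circ\sigma^{ -1}$ (where $(\sigma'\circ\sigma^{ -1})(i)=\sigma'(\sigma^{ -1}(i))$) avoids $\pi$. $S_n^2(\pi_1,\dots,\pi_m)$ denotes the set of $3$-permutations of size $n$ avoiding each of $\pi_1,\dots,\pi_m$. Patterns are written in one-line notation. -}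

module Defs where

open import Data.Nat using (ℕ; zero; suc; _+_; _*_; _∸_; _^_)
open import Data.Bool using (Bool; true; false; _∧_; not; T; if_then_else_)
open import Data.Fin using (Fin; toℕ)
open import Data.Nat using (_<ᵇ_)
open import Data.Bool.ListAction using (all; any)
open import Data.Fin.Properties using () renaming (_≟_ to _≟ᶠ_)
open import Data.List using (List; []; _∷_; map; _++_; allFin)
open import Data.Vec using (Vec; toList; lookup; tabulate)
open import Data.Product using (Σ; _×_; _,_)
open import Relation.Nullary using (does)

-- Conventions: [n] = {1,…,n} is represented by Fin n (value i stands for i+1).
-- A permutation of [n] is written in one-line notation as a vector
-- v = (σ(1), …, σ(n)) ∈ Fin n ^ n; isPerm decides that every value occurs
-- (equivalently, for n entries from n values, that v is a bijection).
isPerm : {n : ℕ} → Vec (Fin n) n → Bool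
isPerm {n} v = all (λ j → any (λ i → does (lookup v i ≟ᶠ j)) (allFin n)) (allFin n)

-- σ⁻¹(i): the first j with σ(j) = i (the unique one when σ is a permutation);
-- the default d is only used if no such j exists (never, for permutations).
preimage : {n : ℕ} → Vec (Fin n) n → Fin n → Fin n → Fin n
preimage {n} σ d i = go (allFin n)
  where
  go : List (Fin n) → Fin n
  go []       = d
  go (j ∷ js) = if does (lookup σ j ≟ᶠ i) then j else go js

compInv : {n : ℕ} → Vec (Fin n) n → Vec (Fin n) n → Vec (Fin n) n
compInv σ σ' = tabulate (λ i → lookup σ' (preimage σ i i))

subseqs : {A : Set} → ℕ → List A → List (List A)
subseqs zero    _        = [] ∷ []
subseqs (suc k) []       = []
subseqs (suc k) (x ∷ xs) = map (x ∷_) (subseqs k xs) ++ subseqs (suc k) xs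

-- Order-isomorphism of two words: same length, and for all positions p < q,
-- a_p < a_q iff b_p < b_q (entries of a permutation are distinct).
sameOrder : {m l : ℕ} → Fin m → Fin m → Fin l → Fin l → Bool
sameOrder a a' b b' with toℕ a <ᵇ toℕ a' | toℕ b <ᵇ toℕ b'
... | true  | true  = true
... | false | false = true
... | _     | _     = false

orderIso : {m l : ℕ} → List (Fin m) → List (Fin l) → Bool
orderIso []       []       = true
orderIso (a ∷ as) (b ∷ bs) = firstOK as bs ∧ orderIso as bs
  where
  firstOK : List _ → List _ → Bool
  firstOK (a' ∷ as') (b' ∷ bs') = sameOrder a a' b b' ∧ firstOK as' bs'
  firstOK []         []         = true
  firstOK _          _          = false
orderIso _        _        = false

contains : {n k : ℕ} → Vec (Fin n) n → Vec (Fin k) k → Bool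
contains {n} {k} τ π = any (λ w → orderIso w (toList π)) (subseqs k (toList τ))

avoids : {n k : ℕ} → Vec (Fin n) n → Vec (Fin k) k → Bool
avoids τ π = not (contains τ π)

avoids3 : {n k : ℕ} → Vec (Fin n) n × Vec (Fin n) n → Vec (Fin k) k → Bool
avoids3 (σ , σ') π = avoids σ π ∧ avoids σ' π ∧ avoids (compInv σ σ') π

p132 : Vec (Fin 3) 3
p132 = tabulate λ { Fin.zero → Fin.zero ; (Fin.suc Fin.zero) → Fin.suc (Fin.suc Fin.zero) ; (Fin.suc (Fin.suc _)) → Fin.suc Fin.zero }

p213 : Vec (Fin 3) 3
p213 = tabulate λ { Fin.zero → Fin.suc Fin.zero ; (Fin.suc Fin.zero) → Fin.zero ; (Fin.suc (Fin.suc _)) → Fin.suc (Fin.suc Fin.zero) }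

S²[132,213] : ℕ → Set
S²[132,213] n = Σ (Vec (Fin n) n × Vec (Fin n) n) λ { (σ , σ') →
  T (isPerm σ ∧ isPerm σ' ∧ avoids3 (σ , σ') p132 ∧ avoids3 (σ , σ') p213) }

-- A permutation avoids 132 and 213 exactly when each of its ascents v i < v j
-- satisfies v j − v i = j − i ("coherence"): it is a decreasing sequence of
-- blocks of consecutive increasing values, and there are 2^(n−1) of them.
-- Reading σ'σ⁻¹ through σ, a 3-permutation (σ, σ') is valid iff σ and σ' are
-- coherent and the value sequences of σ and σ' are coherent with each other.
-- Comparing where σ and σ' take their maximum shows that then σ = id, σ' = id,
-- σ = σ', or both are rotations j ↦ j + a mod n.  Counting these families gives
-- a n + 2n = 3·2^(n−1) + (n−1)n, from which the recurrence follows.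

module Submission where

open import Defs
open import Relation.Binary.Definitions using (tri<; tri≈; tri>)
open import Relation.Unary using (Decidable)
open import Data.Nat using (ℕ; zero; suc; z<s; _≟_; _+_; _*_; _∸_; _^_; _≤_; _<_; _≥_; z≤n; s≤s; _<ᵇ_; _≤?_; _<?_)
open import Data.Nat.Properties
open import Data.Nat.DivMod using (_mod_; _%_; m%n<n; m<n⇒m%n≡m; [m+n]%n≡m%n)
open import Data.Nat.Tactic.RingSolver using (solve-∀)
open import Data.Fin using (Fin; zero; suc; toℕ; fromℕ; fromℕ<; inject₁; punchIn; punchOut)
import Data.Fin.Properties as Fin
open import Data.Fin.Properties
  using (toℕ-injective; toℕ<n; toℕ-fromℕ<; toℕ-fromℕ; toℕ-inject₁; fromℕ≢inject₁; punchIn-injective;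
         punchIn-punchOut; punchOut-punchIn; punchOut-cong; punchInᵢ≢i; punchOut-injective; <⇒notInjective; any?)
  renaming (_≟_ to _≟ᶠ_)
open import Data.Bool using (Bool; true; false; T; not; _∧_; if_then_else_)
open import Data.Bool.Properties using (T-∧; T-irrelevant)
open import Data.Bool.ListAction using (any)
open import Data.List as List using (List; []; _∷_; _++_; allFin; filter; cartesianProduct)
open import Data.List.Membership.Propositional using (_∈_; find; lose)
open import Data.List.Membership.Propositional.Properties
  using (∈-allFin; ∈-lookup; ∈-map⁺; ∈-map⁻; ∈-++⁺ˡ; ∈-++⁺ʳ; ∈-++⁻; ∈-filter⁺; ∈-filter⁻; ∈-cartesianProduct⁺; ∈-cartesianProduct⁻)
open import Data.List.Properties using (length-++; length-map; length-tabulate)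
open import Data.List.Membership.Propositional.Properties.WithK using (unique⇒irrelevant; unique∧set⇒bag)
open import Data.List.Relation.Binary.BagAndSetEquality using (∼bag⇒↭)
open import Data.List.Relation.Binary.Permutation.Propositional.Properties using (↭-length)
open import Data.List.Relation.Unary.Unique.Propositional using (Unique; []; _∷_)
import Data.List.Relation.Unary.Unique.Propositional.Properties as Unique
open import Data.List.Relation.Binary.Disjoint.Propositional using (Disjoint)
open import Data.List.Relation.Unary.Any using (Any; here; there; index)
import Data.List.Relation.Unary.All as All
open import Data.List.Relation.Unary.All.Properties using (all⁺; all⁻)
open import Data.List.Relation.Unary.Any.Properties using (any⁺; any⁻; map⁺; map⁻; ++⁺ˡ; ++⁺ʳ; ++⁻; lookup-index)
open import Data.Vec as Vec using (Vec; []; _∷_; lookup; tabulate; toList)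
open import Data.Vec.Properties using (≡-dec; lookup∘tabulate; lookup-map; ∷-injectiveˡ; ∷-injectiveʳ; tabulate∘lookup; tabulate-cong)
open import Data.Product using (Σ; _×_; _,_; proj₁; proj₂; ∃; ∃₂)
open import Data.Sum using (_⊎_; inj₁; inj₂; [_,_]′)
open import Data.Empty using (⊥-elim)
open import Data.Unit using (tt)
open import Function using (_∘_; id)
open import Function.Bundles using (Equivalence; _⇔_; mk⇔; _↔_; mk↔ₛ′)
open import Function.Construct.Composition using (_↔-∘_)
open import Data.Fin.Permutation using (↔⇒≡)
open import Function.Definitions using (Injective)
open import Relation.Binary.PropositionalEquality using (_≡_; _≢_; refl; sym; trans; cong; cong₂; subst; subst₂; module ≡-Reasoning)
open import Relation.Nullary using (¬_; ¬?; Dec; ofʸ; ofⁿ; yes; no; does; contradiction)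

private
  variable
    n m : ℕ

infixl 20 _!_
_!_ : Vec (Fin n) n → Fin n → ℕ
v ! i = toℕ (lookup v i)

infix 4 _⊖_≃_⊖_
-- a ⊖ b ≃ c ⊖ d says a − b = c − d, stated without truncated subtraction.
record _⊖_≃_⊖_ (a b c d : ℕ) : Set where
  constructor mk≃
  field cross : a + d ≡ b + c
open _⊖_≃_⊖_

module _ {a b c d : ℕ} where
  ≃-sym : a ⊖ b ≃ c ⊖ d → c ⊖ d ≃ a ⊖ b
  ≃-sym (mk≃ a+d≡b+c) = mk≃ (trans (+-comm c b) (trans (sym a+d≡b+c) (+-comm a d)))

  ≃-swap : a ⊖ b ≃ c ⊖ d → a ⊖ c ≃ b ⊖ d
  ≃-swap (mk≃ a+d≡b+c) = mk≃ (trans a+d≡b+c (+-comm b c))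

  ≃-negate : a ⊖ b ≃ c ⊖ d → b ⊖ a ≃ d ⊖ c
  ≃-negate (mk≃ a+d≡b+c) = mk≃ (sym a+d≡b+c)

  ≃-trans : {e f : ℕ} → a ⊖ b ≃ c ⊖ d → c ⊖ d ≃ e ⊖ f → a ⊖ b ≃ e ⊖ f
  ≃-trans {e} {f} (mk≃ a+d≡b+c) (mk≃ c+f≡d+e) = mk≃ (+-cancelʳ-≡ (c + d) (a + f) (b + e) (begin
    (a + f) + (c + d) ≡⟨ exchange a f c d ⟩
    (a + d) + (c + f) ≡⟨ cong₂ _+_ a+d≡b+c c+f≡d+e ⟩
    (b + c) + (d + e) ≡⟨ exchange b c d e ⟩
    (b + e) + (d + c) ≡⟨ cong (b + e +_) (+-comm d c) ⟩
    (b + e) + (c + d) ∎))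
    where
    open ≡-Reasoning
    exchange : ∀ p q r s → (p + q) + (r + s) ≡ (p + s) + (r + q)
    exchange = solve-∀

  ≃-< : a ⊖ b ≃ c ⊖ d → d < c → b < a
  ≃-< (mk≃ a+d≡b+c) d<c = +-cancelʳ-< d b a (subst (b + d <_) (sym a+d≡b+c) (+-monoʳ-< b d<c))

  ≃-≤ : a ⊖ b ≃ c ⊖ d → d ≤ c → b ≤ a
  ≃-≤ (mk≃ a+d≡b+c) d≤c = +-cancelʳ-≤ d b a (subst (b + d ≤_) (sym a+d≡b+c) (+-monoʳ-≤ b d≤c))

module _ {a b c x y z : ℕ} where
  ≃-telescope : a ⊖ b ≃ x ⊖ y → b ⊖ c ≃ y ⊖ z → a ⊖ c ≃ x ⊖ z
  ≃-telescope p q = ≃-swap (≃-trans (≃-swap p) (≃-swap q))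

  ≃-subtractʳ : a ⊖ c ≃ x ⊖ z → b ⊖ c ≃ y ⊖ z → a ⊖ b ≃ x ⊖ y
  ≃-subtractʳ p q = ≃-swap (≃-trans (≃-swap p) (≃-sym (≃-swap q)))

  ≃-subtractˡ : c ⊖ a ≃ z ⊖ x → c ⊖ b ≃ z ⊖ y → b ⊖ a ≃ y ⊖ x
  ≃-subtractˡ p q = ≃-negate (≃-swap (≃-trans (≃-sym (≃-swap p)) (≃-swap q)))

module _ {a b c d : ℕ} where
  ≃-sucʳ : a ⊖ b ≃ c ⊖ d → a ⊖ b ≃ suc c ⊖ suc d
  ≃-sucʳ (mk≃ a+d≡b+c) = mk≃ (trans (+-suc a d) (trans (cong suc a+d≡b+c) (sym (+-suc b c))))

  ≃-sucʳ⁻ : a ⊖ b ≃ suc c ⊖ suc d → a ⊖ b ≃ c ⊖ d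
  ≃-sucʳ⁻ (mk≃ cross) = mk≃ (suc-injective (trans (sym (+-suc a d)) (trans cross (+-suc b c))))

  ≃-sucˡ : a ⊖ b ≃ c ⊖ d → suc a ⊖ suc b ≃ c ⊖ d
  ≃-sucˡ (mk≃ a+d≡b+c) = mk≃ (cong suc a+d≡b+c)

  ≃-sucˡ⁻ : suc a ⊖ suc b ≃ c ⊖ d → a ⊖ b ≃ c ⊖ d
  ≃-sucˡ⁻ (mk≃ cross) = mk≃ (suc-injective cross)

≃-cong : ∀ {a a' b b' c d} → a ≡ a' → b ≡ b' → a ⊖ b ≃ c ⊖ d → a' ⊖ b' ≃ c ⊖ d
≃-cong refl refl gap = gap

≃-cancel-minuend : ∀ {a b c} → a ⊖ b ≃ a ⊖ c → c ≡ b
≃-cancel-minuend {a} {b} (mk≃ a+c≡b+a) = +-cancelˡ-≡ a _ _ (trans a+c≡b+a (+-comm b a))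

≃-offset : ∀ a i j → a + j ⊖ a + i ≃ j ⊖ i
≃-offset a i j = mk≃ (rearrange a i j)
  where
  rearrange : ∀ a i j → (a + j) + i ≡ (a + i) + j
  rearrange = solve-∀

module _ {a b c d k : ℕ} where
  ≃-cancel-+ : a + k ⊖ b + k ≃ c ⊖ d → a ⊖ b ≃ c ⊖ d
  ≃-cancel-+ (mk≃ cross) = mk≃ (+-cancelʳ-≡ k _ _ (begin
    (a + d) + k ≡⟨ swap-last a d k ⟩
    (a + k) + d ≡⟨ cross ⟩
    (b + k) + c ≡⟨ swap-last b k c ⟩
    (b + c) + k ∎))
    where
    open ≡-Reasoning
    swap-last : ∀ x y z → (x + y) + z ≡ (x + z) + y
    swap-last = solve-∀

  ≃-shift : a ⊖ b + k ≃ c ⊖ d → a ⊖ b ≃ c + k ⊖ d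
  ≃-shift (mk≃ cross) = mk≃ (trans cross (trans (+-assoc b k c) (cong (b +_) (+-comm k c))))

lookup-ext : {A : Set} {v w : Vec A n} → (∀ i → lookup v i ≡ lookup w i) → v ≡ w
lookup-ext {v = v} {w} v≗w = trans (sym (tabulate∘lookup v)) (trans (tabulate-cong v≗w) (tabulate∘lookup w))

module _ {A : Set} where
  length-filter-split : {P : A → Set} (P? : Decidable P) (xs : List A) →
    List.length (filter P? xs) + List.length (filter (¬? ∘ P?) xs) ≡ List.length xs
  length-filter-split P? []       = refl
  length-filter-split P? (x ∷ xs) with P? x
  ... | yes _ = cong suc (length-filter-split P? xs)
  ... | no _  = trans (+-suc _ _) (cong suc (length-filter-split P? xs))

  length-cartesianProduct : {B : Set} (xs : List A) (ys : List B) →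
    List.length (cartesianProduct xs ys) ≡ List.length xs * List.length ys
  length-cartesianProduct []       ys = refl
  length-cartesianProduct (x ∷ xs) ys = begin
    List.length (List.map (x ,_) ys ++ cartesianProduct xs ys)          ≡⟨ length-++ (List.map (x ,_) ys) ⟩
    List.length (List.map (x ,_) ys) + List.length (cartesianProduct xs ys) ≡⟨ cong₂ _+_ (length-map (x ,_) ys) (length-cartesianProduct xs ys) ⟩
    List.length ys + List.length xs * List.length ys                    ∎
    where open ≡-Reasoning

  unique-sameMembers⇒length≡ : {xs ys : List A} → Unique xs → Unique ys → (∀ {x} → x ∈ xs ⇔ x ∈ ys) →
    List.length xs ≡ List.length ys
  unique-sameMembers⇒length≡ xs-unique ys-unique same = ↭-length (∼bag⇒↭ (unique∧set⇒bag xs-unique ys-unique same))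

  index-∈-lookup : (xs : List A) (i : Fin (List.length xs)) → index (∈-lookup {xs = xs} i) ≡ i
  index-∈-lookup (x ∷ xs) zero    = refl
  index-∈-lookup (x ∷ xs) (suc i) = cong suc (index-∈-lookup xs i)

  unique-members-↔ : (xs : List A) → Unique xs → Σ A (_∈ xs) ↔ Fin (List.length xs)
  unique-members-↔ xs xs-unique =
    mk↔ₛ′ (λ (_ , x∈) → index x∈) (λ i → List.lookup xs i , ∈-lookup i) (index-∈-lookup xs) lookup-index-∈
    where
    lookup-index-∈ : ∀ (p : Σ A (_∈ xs)) → _≡_ {A = Σ A (_∈ xs)} (List.lookup xs (index (proj₂ p)) , ∈-lookup (index (proj₂ p))) p
    lookup-index-∈ (x , x∈) with List.lookup xs (index x∈) | lookup-index x∈ | ∈-lookup {xs = xs} (index x∈)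
    ... | _ | refl | x∈′ = cong (x ,_) (unique⇒irrelevant xs-unique x∈′ x∈)

  unique-enumeration-↔ : {P : A → Set} (xs : List A) → Unique xs → (∀ {x} → P x ⇔ x ∈ xs) →
    (∀ {x} (p q : P x) → p ≡ q) → Σ A P ↔ Fin (List.length xs)
  unique-enumeration-↔ xs xs-unique P⇔∈ P-irrelevant = unique-members-↔ xs xs-unique ↔-∘ mk↔ₛ′
    (λ (x , p) → x , Equivalence.to P⇔∈ p) (λ (x , x∈) → x , Equivalence.from P⇔∈ x∈)
    (λ (x , _) → cong (x ,_) (unique⇒irrelevant xs-unique _ _)) (λ (x , _) → cong (x ,_) (P-irrelevant _ _))

module _ {A : Set} where
  subseqs₁⁻ : {P : List A → Set} (v : Vec A m) → Any P (subseqs 1 (toList v)) →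
              ∃ λ i → P (lookup v i ∷ [])
  subseqs₁⁻ (x ∷ v) (here p)  = zero , p
  subseqs₁⁻ (x ∷ v) (there p) = let i , q = subseqs₁⁻ v p in suc i , q

  subseqs₁⁺ : {P : List A → Set} (v : Vec A m) (i : Fin m) → P (lookup v i ∷ []) →
              Any P (subseqs 1 (toList v))
  subseqs₁⁺ (x ∷ v) zero    p = here p
  subseqs₁⁺ (x ∷ v) (suc i) p = there (subseqs₁⁺ v i p)

  subseqs₂⁻ : {P : List A → Set} (v : Vec A m) → Any P (subseqs 2 (toList v)) →
              ∃₂ λ i j → toℕ i < toℕ j × P (lookup v i ∷ lookup v j ∷ [])
  subseqs₂⁻ (x ∷ v) p with ++⁻ (List.map (x ∷_) (subseqs 1 (toList v))) p
  ... | inj₁ p₁ = let j , q = subseqs₁⁻ v (map⁻ p₁) in zero , suc j , s≤s z≤n , q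
  ... | inj₂ p₂ = let i , j , i<j , q = subseqs₂⁻ v p₂ in suc i , suc j , s≤s i<j , q

  subseqs₂⁺ : {P : List A → Set} (v : Vec A m) (i j : Fin m) → toℕ i < toℕ j →
              P (lookup v i ∷ lookup v j ∷ []) → Any P (subseqs 2 (toList v))
  subseqs₂⁺ (x ∷ v) zero    (suc j) _         p = ++⁺ˡ (map⁺ (subseqs₁⁺ v j p))
  subseqs₂⁺ (x ∷ v) (suc i) (suc j) (s≤s i<j) p =
    ++⁺ʳ (List.map (x ∷_) (subseqs 1 (toList v))) (subseqs₂⁺ v i j i<j p)

  subseqs₃⁻ : {P : List A → Set} (v : Vec A m) → Any P (subseqs 3 (toList v)) →
              ∃₂ λ i j → ∃ λ k → toℕ i < toℕ j × toℕ j < toℕ k × P (lookup v i ∷ lookup v j ∷ lookup v k ∷ [])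
  subseqs₃⁻ (x ∷ v) p with ++⁻ (List.map (x ∷_) (subseqs 2 (toList v))) p
  ... | inj₁ p₁ = let j , k , j<k , q = subseqs₂⁻ v (map⁻ p₁) in zero , suc j , suc k , s≤s z≤n , s≤s j<k , q
  ... | inj₂ p₂ = let i , j , k , i<j , j<k , q = subseqs₃⁻ v p₂ in suc i , suc j , suc k , s≤s i<j , s≤s j<k , q

  subseqs₃⁺ : {P : List A → Set} (v : Vec A m) (i j k : Fin m) → toℕ i < toℕ j → toℕ j < toℕ k →
              P (lookup v i ∷ lookup v j ∷ lookup v k ∷ []) → Any P (subseqs 3 (toList v))
  subseqs₃⁺ (x ∷ v) zero    (suc j) (suc k) _         (s≤s j<k) p = ++⁺ˡ (map⁺ (subseqs₂⁺ v j k j<k p))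
  subseqs₃⁺ (x ∷ v) (suc i) (suc j) (suc k) (s≤s i<j) (s≤s j<k) p =
    ++⁺ʳ (List.map (x ∷_) (subseqs 2 (toList v))) (subseqs₃⁺ v i j k i<j j<k p)

does-sound : {P : Set} (P? : Dec P) → T (does P?) → P
does-sound (yes p) _ = p

does-complete : {P : Set} (P? : Dec P) → P → T (does P?)
does-complete (yes _) _ = tt
does-complete (no ¬p) p = ¬p p

T-not⁻ : ∀ {b} → T (not b) → ¬ T b
T-not⁻ {false} _ ()

T-not⁺ : ∀ {b} → ¬ T b → T (not b)
T-not⁺ {false} _  = tt
T-not⁺ {true}  ¬t = ¬t tt

∧-split : ∀ {a b} → T (a ∧ b) → T a × T b
∧-split {a} = Equivalence.to (T-∧ {a})

∧-join : ∀ {a b} → T a → T b → T (a ∧ b)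
∧-join {a} ta tb = Equivalence.from (T-∧ {a}) (ta , tb)

-- Permutations as vectors

Onto : Vec (Fin n) n → Set
Onto {n} v = ∀ (w : Fin n) → ∃ λ i → lookup v i ≡ w

isPerm⇒onto : (v : Vec (Fin n) n) → T (isPerm v) → Onto v
isPerm⇒onto {n} v isPerm-v w =
  let i , _ , hit = find (any⁻ _ (allFin n) (All.lookup (all⁺ _ (allFin n) isPerm-v) (∈-allFin w)))
  in i , does-sound (lookup v i ≟ᶠ w) hit

onto⇒isPerm : (v : Vec (Fin n) n) → Onto v → T (isPerm v)
onto⇒isPerm {n} v onto = all⁻ (λ w → any (hits w) (allFin n)) {xs = allFin n} (All.tabulate λ {w} _ →
  let i , vi≡w = onto w in any⁺ (hits w) (lose (∈-allFin i) (does-complete (lookup v i ≟ᶠ w) vi≡w)))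
  where
  hits : Fin n → Fin n → Bool
  hits w i = does (lookup v i ≟ᶠ w)

injective⇒onto : (f : Fin n → Fin n) → Injective _≡_ _≡_ f → ∀ w → ∃ λ a → f a ≡ w
injective⇒onto {suc n} f f-inj w with any? (λ a → f a ≟ᶠ w)
... | yes hit = hit
... | no miss = contradiction (λ {a b} → squeeze-injective {a} {b}) (<⇒notInjective (n<1+n n))
  where
  missed : ∀ a → w ≢ f a
  missed a w≡fa = miss (a , sym w≡fa)
  squeeze : Fin (suc n) → Fin n
  squeeze a = punchOut (missed a)
  squeeze-injective : Injective _≡_ _≡_ squeeze
  squeeze-injective {a} {b} = f-inj ∘ punchOut-injective (missed a) (missed b)

module _ (v : Vec (Fin n) n) (onto : Onto v) where
  private
    section : Fin n → Fin n
    section w = proj₁ (onto w)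

    cancel : ∀ w → lookup v (section w) ≡ w
    cancel w = proj₂ (onto w)

    section-injective : Injective _≡_ _≡_ section
    section-injective {a} {b} sa≡sb = trans (sym (cancel a)) (trans (cong (lookup v) sa≡sb) (cancel b))

  onto⇒injective : Injective _≡_ _≡_ (lookup v)
  onto⇒injective {i} {j} vi≡vj
    with a , sa≡i ← injective⇒onto section section-injective i
       | b , sb≡j ← injective⇒onto section section-injective j =
    trans (sym sa≡i) (trans (cong section a≡b) sb≡j)
    where
    a≡b : a ≡ b
    a≡b = begin
      a                    ≡⟨ sym (cancel a) ⟩
      lookup v (section a) ≡⟨ cong (lookup v) sa≡i ⟩
      lookup v i           ≡⟨ vi≡vj ⟩
      lookup v j           ≡⟨ cong (lookup v) (sym sb≡j) ⟩
      lookup v (section b) ≡⟨ cancel b ⟩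
      b                    ∎
      where open ≡-Reasoning

positionOf : (v : Vec (Fin n) n) → Onto v → ∀ w → w < n → ∃ λ p → v ! p ≡ w
positionOf v onto w w<n = let p , vp≡w = onto (fromℕ< w<n) in p , trans (cong toℕ vp≡w) (toℕ-fromℕ< w<n)

module _ (σ : Vec (Fin n) n) (w : Fin n) (search : List (Fin n) → Fin n)
         (search-∷ : ∀ j js → search (j ∷ js) ≡ (if does (lookup σ j ≟ᶠ w) then j else search js)) where
  search-finds : ∀ {j xs} → j ∈ xs → lookup σ j ≡ w → lookup σ (search xs) ≡ w
  search-finds {j} {k ∷ ks} j∈ σj≡w rewrite search-∷ k ks with lookup σ k ≟ᶠ w | j∈
  ... | yes σk≡w | _          = σk≡w
  ... | no σk≢w  | here refl  = contradiction σj≡w σk≢w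
  ... | no _     | there j∈ks = search-finds j∈ks σj≡w

-- The search performed by preimage is local to its definition; abstracting
-- allFin n lets unification recover it as the argument of search-finds.
preimage-finds : (σ : Vec (Fin n) n) (d w j : Fin n) → lookup σ j ≡ w → lookup σ (preimage σ d w) ≡ w
preimage-finds {n} σ d w j σj≡w with allFin n | ∈-allFin j | search-finds σ w _ (λ _ _ → refl)
... | _ | j∈ | finds = finds j∈ σj≡w

compInv-lookup : (σ σ' : Vec (Fin n) n) → Onto σ → ∀ i → lookup (compInv σ σ') (lookup σ i) ≡ lookup σ' i
compInv-lookup σ σ' onto i = begin
  lookup (compInv σ σ') (lookup σ i)
    ≡⟨ lookup∘tabulate _ (lookup σ i) ⟩
  lookup σ' (preimage σ (lookup σ i) (lookup σ i))
    ≡⟨ cong (lookup σ') (onto⇒injective σ onto (preimage-finds σ _ _ i refl)) ⟩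
  lookup σ' i ∎
  where open ≡-Reasoning

compInv-onto : (σ σ' : Vec (Fin n) n) → Onto σ → Onto σ' → Onto (compInv σ σ')
compInv-onto σ σ' onto onto' w =
  let i , σ'i≡w = onto' w in lookup σ i , trans (compInv-lookup σ σ' onto i) σ'i≡w

-- Pattern avoidance and coherence

Avoids : (ℕ → ℕ → ℕ → Set) → Vec (Fin n) n → Set
Avoids Pattern v = ∀ i j k → toℕ i < toℕ j → toℕ j < toℕ k → ¬ Pattern (v ! i) (v ! j) (v ! k)

module _ (π : Vec (Fin 3) 3) (Pattern : ℕ → ℕ → ℕ → Set)
         (matches⇒ : ∀ {n} (a b c : Fin n) → T (orderIso (a ∷ b ∷ c ∷ []) (toList π)) → Pattern (toℕ a) (toℕ b) (toℕ c))
         (matches⇐ : ∀ {n} (a b c : Fin n) → Pattern (toℕ a) (toℕ b) (toℕ c) → T (orderIso (a ∷ b ∷ c ∷ []) (toList π)))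
         where
  avoids⇒Avoids : (v : Vec (Fin n) n) → T (avoids v π) → Avoids Pattern v
  avoids⇒Avoids v v-avoids i j k i<j j<k occurrence =
    T-not⁻ v-avoids (any⁺ _ (subseqs₃⁺ v i j k i<j j<k (matches⇐ _ _ _ occurrence)))

  Avoids⇒avoids : (v : Vec (Fin n) n) → Avoids Pattern v → T (avoids v π)
  Avoids⇒avoids v v-avoids = T-not⁺ λ v-contains →
    let i , j , k , i<j , j<k , match = subseqs₃⁻ v (any⁻ _ _ v-contains)
    in v-avoids i j k i<j j<k (matches⇒ _ _ _ match)

-- orderIso compares entries with <ᵇ only, hence the non-strict c ≤ b and b ≤ a.
Pattern132 : ℕ → ℕ → ℕ → Set
Pattern132 a b c = a < b × a < c × c ≤ b

Pattern213 : ℕ → ℕ → ℕ → Set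
Pattern213 a b c = b ≤ a × a < c × b < c

module _ (a b c : Fin n) where
  private
    A = toℕ a
    B = toℕ b
    C = toℕ c

  orderIso-132⇒ : T (orderIso (a ∷ b ∷ c ∷ []) (toList p132)) → Pattern132 A B C
  orderIso-132⇒ _ with A <ᵇ B | <ᵇ-reflects-< A B | A <ᵇ C | <ᵇ-reflects-< A C | B <ᵇ C | <ᵇ-reflects-< B C
  ... | true | ofʸ a<b | true | ofʸ a<c | false | ofⁿ b≮c = a<b , a<c , ≮⇒≥ b≮c

  orderIso-132⇐ : Pattern132 A B C → T (orderIso (a ∷ b ∷ c ∷ []) (toList p132))
  orderIso-132⇐ (a<b , a<c , c≤b) with A <ᵇ B | <ᵇ-reflects-< A B | A <ᵇ C | <ᵇ-reflects-< A C | B <ᵇ C | <ᵇ-reflects-< B C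
  ... | true  | _        | true  | _        | false | _       = tt
  ... | false | ofⁿ a≮b | _     | _        | _     | _       = contradiction a<b a≮b
  ... | _     | _        | false | ofⁿ a≮c | _     | _       = contradiction a<c a≮c
  ... | _     | _        | _     | _        | true  | ofʸ b<c = contradiction c≤b (<⇒≱ b<c)

  orderIso-213⇒ : T (orderIso (a ∷ b ∷ c ∷ []) (toList p213)) → Pattern213 A B C
  orderIso-213⇒ _ with A <ᵇ B | <ᵇ-reflects-< A B | A <ᵇ C | <ᵇ-reflects-< A C | B <ᵇ C | <ᵇ-reflects-< B C
  ... | false | ofⁿ a≮b | true | ofʸ a<c | true | ofʸ b<c = ≮⇒≥ a≮b , a<c , b<c

  orderIso-213⇐ : Pattern213 A B C → T (orderIso (a ∷ b ∷ c ∷ []) (toList p213))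
  orderIso-213⇐ (b≤a , a<c , b<c) with A <ᵇ B | <ᵇ-reflects-< A B | A <ᵇ C | <ᵇ-reflects-< A C | B <ᵇ C | <ᵇ-reflects-< B C
  ... | false | _       | true  | _        | true  | _        = tt
  ... | true  | ofʸ a<b | _     | _        | _     | _        = contradiction b≤a (<⇒≱ a<b)
  ... | _     | _       | false | ofⁿ a≮c | _     | _        = contradiction a<c a≮c
  ... | _     | _       | _     | _        | false | ofⁿ b≮c = contradiction b<c b≮c

avoids-132⇒ : (v : Vec (Fin n) n) → T (avoids v p132) → Avoids Pattern132 v
avoids-132⇒ = avoids⇒Avoids p132 Pattern132 orderIso-132⇒ orderIso-132⇐

avoids-132⇐ : (v : Vec (Fin n) n) → Avoids Pattern132 v → T (avoids v p132)
avoids-132⇐ = Avoids⇒avoids p132 Pattern132 orderIso-132⇒ orderIso-132⇐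

avoids-213⇒ : (v : Vec (Fin n) n) → T (avoids v p213) → Avoids Pattern213 v
avoids-213⇒ = avoids⇒Avoids p213 Pattern213 orderIso-213⇒ orderIso-213⇐

avoids-213⇐ : (v : Vec (Fin n) n) → Avoids Pattern213 v → T (avoids v p213)
avoids-213⇐ = Avoids⇒avoids p213 Pattern213 orderIso-213⇒ orderIso-213⇐

Coherent : (Fin n → ℕ) → (Fin n → ℕ) → Set
Coherent {n} f g = ∀ i j → f i < f j → g i < g j → g j ⊖ g i ≃ f j ⊖ f i

coherent-sym : {f g : Fin n → ℕ} → Coherent f g → Coherent g f
coherent-sym coh i j gi<gj fi<fj = ≃-sym (coh i j fi<fj gi<gj)

coherent-refl : (f : Fin n → ℕ) → Coherent f f
coherent-refl f i j _ _ = mk≃ (+-comm (f j) (f i))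

module _ (v : Vec (Fin n) n) (coh : Coherent toℕ (v !_)) where
  coherent⇒avoids132 : Avoids Pattern132 v
  coherent⇒avoids132 i j k i<j j<k (vi<vj , vi<vk , vk≤vj) =
    <⇒≱ (≃-< (≃-subtractʳ (coh i k (<-trans i<j j<k) vi<vk) (coh i j i<j vi<vj)) j<k) vk≤vj

  coherent⇒avoids213 : Avoids Pattern213 v
  coherent⇒avoids213 i j k i<j j<k (vj≤vi , vi<vk , vj<vk) =
    <⇒≱ (≃-< (≃-subtractˡ (coh i k (<-trans i<j j<k) vi<vk) (coh j k j<k vj<vk)) i<j) vj≤vi

module _ (v : Vec (Fin n) n) (onto : Onto v) (no132 : Avoids Pattern132 v) (no213 : Avoids Pattern213 v) where
  private
    next-< : ∀ {i i' : Fin n} → toℕ i' ≡ suc (toℕ i) → toℕ i < toℕ i'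
    next-< i'≡1+i = subst (_ <_) (sym i'≡1+i) (n<1+n _)

    ascent-step : ∀ i i' → toℕ i' ≡ suc (toℕ i) → v ! i < v ! i' → v ! i' ≡ suc (v ! i)
    ascent-step i i' i'≡1+i vi<vi'
      with k , vk≡1+vi ← positionOf v onto (suc (v ! i)) (≤-<-trans vi<vi' (toℕ<n (lookup v i')))
      with <-cmp (toℕ k) (toℕ i) | <-cmp (toℕ k) (toℕ i')
    ... | tri< k<i _ _ | _ = ≤-antisym (≮⇒≥ λ 1+vi<vi' → no213 k i i' k<i (next-< i'≡1+i)
          (subst (v ! i ≤_) (sym vk≡1+vi) (n≤1+n _) , subst (_< v ! i') (sym vk≡1+vi) 1+vi<vi' , vi<vi')) vi<vi'
    ... | tri≈ _ k≡i _ | _ = contradiction (trans (sym vk≡1+vi) (cong (v !_) (toℕ-injective k≡i))) 1+n≢n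
    ... | tri> _ _ i<k | tri< k<i' _ _ = contradiction (subst (_ <_) i'≡1+i k<i') (≤⇒≯ i<k)
    ... | _ | tri≈ _ k≡i' _ = trans (cong (v !_) (sym (toℕ-injective k≡i'))) vk≡1+vi
    ... | tri> _ _ i<k | tri> _ _ i'<k = ⊥-elim (no132 i i' k (next-< i'≡1+i) i'<k
          (vi<vi' , subst (v ! i <_) (sym vk≡1+vi) (n<1+n _) , subst (_≤ v ! i') (sym vk≡1+vi) vi<vi'))

    ascent-translates : ∀ d i j → toℕ j ≡ suc (d + toℕ i) → v ! i < v ! j → v ! j ⊖ v ! i ≃ toℕ j ⊖ toℕ i
    ascent-translates zero i j j≡1+i vi<vj = mk≃ (begin
      v ! j + toℕ i       ≡⟨ cong (_+ toℕ i) (ascent-step i j j≡1+i vi<vj) ⟩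
      suc (v ! i) + toℕ i ≡⟨ +-suc (v ! i) (toℕ i) ⟨
      v ! i + suc (toℕ i) ≡⟨ cong (v ! i +_) j≡1+i ⟨
      v ! i + toℕ j       ∎)
      where open ≡-Reasoning
    ascent-translates (suc d) i j j≡ vi<vj = translates
      where
      1+i<j : suc (toℕ i) < toℕ j
      1+i<j = subst (suc (toℕ i) <_) (sym j≡) (s≤s (s≤s (m≤n+m (toℕ i) d)))
      k : Fin n
      k = fromℕ< (<-trans 1+i<j (toℕ<n j))
      k≡1+i : toℕ k ≡ suc (toℕ i)
      k≡1+i = toℕ-fromℕ< _
      i<k : toℕ i < toℕ k
      i<k = next-< k≡1+i
      k<j : toℕ k < toℕ j
      k<j = subst (_< toℕ j) (sym k≡1+i) 1+i<j
      translates : v ! j ⊖ v ! i ≃ toℕ j ⊖ toℕ i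
      translates with v ! k ≤? v ! i | v ! j ≤? v ! k
      ... | yes vk≤vi | _         = ⊥-elim (no213 i k j i<k k<j (vk≤vi , vi<vj , ≤-<-trans vk≤vi vi<vj))
      ... | no vk≰vi  | yes vj≤vk = ⊥-elim (no132 i k j i<k k<j (≰⇒> vk≰vi , vi<vj , vj≤vk))
      ... | no vk≰vi  | no vj≰vk  =
        ≃-telescope (ascent-translates d k j j≡1+d+k (≰⇒> vj≰vk)) (ascent-translates zero i k k≡1+i (≰⇒> vk≰vi))
        where
        j≡1+d+k : toℕ j ≡ suc (d + toℕ k)
        j≡1+d+k = trans j≡ (cong suc (trans (sym (+-suc d (toℕ i))) (cong (d +_) (sym k≡1+i))))

  avoidance⇒coherent : Coherent toℕ (v !_)
  avoidance⇒coherent i j i<j = ascent-translates (toℕ j ∸ suc (toℕ i)) i j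
    (sym (trans (sym (+-suc _ (toℕ i))) (m∸n+n≡m i<j)))

record CoherentPerm (v : Vec (Fin n) n) : Set where
  constructor coherentPerm
  field
    onto     : Onto v
    coherent : Coherent toℕ (v !_)
open CoherentPerm

-- Coherence of σ with σ' is coherence of σ' ∘ σ⁻¹ read through σ.
CoherentPair : Vec (Fin n) n → Vec (Fin n) n → Set
CoherentPair σ σ' = CoherentPerm σ × CoherentPerm σ' × Coherent (σ !_) (σ' !_)

module _ (σ σ' : Vec (Fin n) n) (onto : Onto σ) where
  private
    τ = compInv σ σ'
    τσ≡σ' : ∀ i → τ ! lookup σ i ≡ σ' ! i
    τσ≡σ' i = cong toℕ (compInv-lookup σ σ' onto i)

  compInv-coherent⇒ : Coherent toℕ (τ !_) → Coherent (σ !_) (σ' !_)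
  compInv-coherent⇒ coh i j σi<σj σ'i<σ'j =
    subst₂ (λ a b → a ⊖ b ≃ σ ! j ⊖ σ ! i) (τσ≡σ' j) (τσ≡σ' i)
      (coh (lookup σ i) (lookup σ j) σi<σj (subst₂ _<_ (sym (τσ≡σ' i)) (sym (τσ≡σ' j)) σ'i<σ'j))

  compInv-coherent⇐ : Coherent (σ !_) (σ' !_) → Coherent toℕ (τ !_)
  compInv-coherent⇐ coh p q p<q τp<τq
    with i , refl ← onto p | j , refl ← onto q =
    subst₂ (λ a b → a ⊖ b ≃ σ ! j ⊖ σ ! i) (sym (τσ≡σ' j)) (sym (τσ≡σ' i))
      (coh i j p<q (subst₂ _<_ (τσ≡σ' i) (τσ≡σ' j) τp<τq))

module _ (v : Vec (Fin n) n) where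
  avoiding⇒coherent : Onto v → T (avoids v p132) → T (avoids v p213) → Coherent toℕ (v !_)
  avoiding⇒coherent onto no132 no213 = avoidance⇒coherent v onto (avoids-132⇒ v no132) (avoids-213⇒ v no213)

  coherent⇒avoiding : Coherent toℕ (v !_) → T (avoids v p132) × T (avoids v p213)
  coherent⇒avoiding coh = avoids-132⇐ v (coherent⇒avoids132 v coh) , avoids-213⇐ v (coherent⇒avoids213 v coh)

module _ (σ σ' : Vec (Fin n) n) where
  private
    τ = compInv σ σ'

  S²-member⇒coherentPair : T (isPerm σ ∧ isPerm σ' ∧ avoids3 (σ , σ') p132 ∧ avoids3 (σ , σ') p213) → CoherentPair σ σ'
  S²-member⇒coherentPair member =
    let perm , rest = ∧-split {isPerm σ} member
        perm' , avoid = ∧-split {isPerm σ'} rest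
        avoid132 , avoid213 = ∧-split {avoids3 (σ , σ') p132} avoid
        σ-132 , rest132 = ∧-split {avoids σ p132} avoid132
        σ'-132 , τ-132 = ∧-split {avoids σ' p132} rest132
        σ-213 , rest213 = ∧-split {avoids σ p213} avoid213
        σ'-213 , τ-213 = ∧-split {avoids σ' p213} rest213
        σ-onto = isPerm⇒onto σ perm
        σ'-onto = isPerm⇒onto σ' perm'
    in coherentPerm σ-onto (avoiding⇒coherent σ σ-onto σ-132 σ-213)
     , coherentPerm σ'-onto (avoiding⇒coherent σ' σ'-onto σ'-132 σ'-213)
     , compInv-coherent⇒ σ σ' σ-onto (avoiding⇒coherent τ (compInv-onto σ σ' σ-onto σ'-onto) τ-132 τ-213)

  coherentPair⇒S²-member : CoherentPair σ σ' → T (isPerm σ ∧ isPerm σ' ∧ avoids3 (σ , σ') p132 ∧ avoids3 (σ , σ') p213)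
  coherentPair⇒S²-member (coherentPerm σ-onto σ-coh , coherentPerm σ'-onto σ'-coh , σσ'-coh) =
    let σ-132 , σ-213 = coherent⇒avoiding σ σ-coh
        σ'-132 , σ'-213 = coherent⇒avoiding σ' σ'-coh
        τ-132 , τ-213 = coherent⇒avoiding τ (compInv-coherent⇐ σ σ' σ-onto σσ'-coh)
    in ∧-join {isPerm σ} (onto⇒isPerm σ σ-onto) (∧-join {isPerm σ'} (onto⇒isPerm σ' σ'-onto)
         (∧-join {avoids3 (σ , σ') p132}
           (∧-join {avoids σ p132} σ-132 (∧-join {avoids σ' p132} σ'-132 τ-132))
           (∧-join {avoids σ p213} σ-213 (∧-join {avoids σ' p213} σ'-213 τ-213))))

-- Rotations

rotation : Fin (suc m) → Vec (Fin (suc m)) (suc m)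
rotation {m} a = tabulate λ j → (toℕ a + toℕ j) mod suc m

identity : Vec (Fin (suc m)) (suc m)
identity = rotation zero

record RotatesBy (a : ℕ) (v : Vec (Fin n) n) : Set where
  constructor rotates
  field at : ∀ j → (a + toℕ j < n × v ! j ≡ a + toℕ j) ⊎ (v ! j + n ≡ a + toℕ j)
open RotatesBy

rotation-lookup : (a j : Fin (suc m)) →
  (toℕ a + toℕ j < suc m × rotation a ! j ≡ toℕ a + toℕ j) ⊎ (rotation a ! j + suc m ≡ toℕ a + toℕ j)
rotation-lookup {m} a j
  rewrite lookup∘tabulate (λ j → (toℕ a + toℕ j) mod suc m) j | toℕ-fromℕ< (m%n<n (toℕ a + toℕ j) (suc m))
  with toℕ a + toℕ j <? suc m
... | yes a+j<n = inj₁ (a+j<n , m<n⇒m%n≡m a+j<n)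
... | no a+j≮n = inj₂ (begin
  (A + J) % N + N           ≡⟨ cong (λ x → x % N + N) (m∸n+n≡m N≤a+j) ⟨
  (A + J ∸ N + N) % N + N   ≡⟨ cong (_+ N) ([m+n]%n≡m%n (A + J ∸ N) N) ⟩
  (A + J ∸ N) % N + N       ≡⟨ cong (_+ N) (m<n⇒m%n≡m wrapped<N) ⟩
  A + J ∸ N + N             ≡⟨ m∸n+n≡m N≤a+j ⟩
  A + J                     ∎)
  where
  open ≡-Reasoning
  A = toℕ a
  J = toℕ j
  N = suc m
  N≤a+j : N ≤ A + J
  N≤a+j = ≮⇒≥ a+j≮n
  wrapped<N : A + J ∸ N < N
  wrapped<N = subst (A + J ∸ N <_) (m+n∸n≡m N N) (∸-monoˡ-< (+-mono-< (toℕ<n a) (toℕ<n j)) N≤a+j)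

rotation-rotatesBy : (a : Fin (suc m)) → RotatesBy (toℕ a) (rotation a)
rotation-rotatesBy a = rotates (rotation-lookup a)

module _ {a : ℕ} {v : Vec (Fin n) n} (rot : RotatesBy a v) where
  private
    gap-of-lifts : ∀ {x y} (i j : Fin n) → x ≡ a + toℕ i → y ≡ a + toℕ j → y ⊖ x ≃ toℕ j ⊖ toℕ i
    gap-of-lifts i j refl refl = ≃-offset a (toℕ i) (toℕ j)

  rotatesBy-gap : ∀ i j → v ! i < v ! j →
    (toℕ i < toℕ j × v ! j ⊖ v ! i ≃ toℕ j ⊖ toℕ i) ⊎ (toℕ j < toℕ i × v ! j ⊖ v ! i ≃ toℕ j + n ⊖ toℕ i)
  rotatesBy-gap i j vi<vj with at rot i | at rot j
  ... | inj₁ (_ , vi≡a+i) | inj₁ (_ , vj≡a+j) = inj₁ (≃-< (≃-sym gap) vi<vj , gap)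
    where gap = gap-of-lifts i j vi≡a+i vj≡a+j
  ... | inj₂ vi+n≡a+i | inj₂ vj+n≡a+j = inj₁ (≃-< (≃-sym gap) vi<vj , gap)
    where gap = ≃-cancel-+ (gap-of-lifts i j vi+n≡a+i vj+n≡a+j)
  ... | inj₁ (_ , vi≡a+i) | inj₂ vj+n≡a+j = contradiction (<-≤-trans vj<a a≤vi) (<-asym vi<vj)
    where
    vj<a : v ! j < a
    vj<a = +-cancelʳ-< n (v ! j) a (subst (_< a + n) (sym vj+n≡a+j) (+-monoʳ-< a (toℕ<n j)))
    a≤vi : a ≤ v ! i
    a≤vi = subst (a ≤_) (sym vi≡a+i) (m≤m+n a (toℕ i))
  ... | inj₂ vi+n≡a+i | inj₁ (a+j<n , vj≡a+j) = inj₂ (j<i , ≃-shift (gap-of-lifts i j vi+n≡a+i vj≡a+j))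
    where
    j<i : toℕ j < toℕ i
    j<i = +-cancelˡ-< a (toℕ j) (toℕ i) (<-≤-trans a+j<n (subst (n ≤_) vi+n≡a+i (m≤n+m n (v ! i))))

  rotatesBy⇒coherent : Coherent toℕ (v !_)
  rotatesBy⇒coherent i j i<j vi<vj with rotatesBy-gap i j vi<vj
  ... | inj₁ (_ , gap)  = gap
  ... | inj₂ (j<i , _) = contradiction j<i (<-asym i<j)

  rotatesBy⇒injective : Injective _≡_ _≡_ (lookup v)
  rotatesBy⇒injective {i} {j} vi≡vj = toℕ-injective (+-cancelˡ-≡ a _ _ (same-lift (at rot i) (at rot j)))
    where
    vi≡vj' : v ! i ≡ v ! j
    vi≡vj' = cong toℕ vi≡vj
    lift-clash : ∀ {k l x} → x ≡ a + toℕ k → x + n ≢ a + toℕ l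
    lift-clash {k} {l} x≡a+k x+n≡a+l = <⇒≱ (+-monoʳ-< a (toℕ<n l))
      (subst (a + n ≤_) (trans (cong (_+ n) (sym x≡a+k)) x+n≡a+l) (+-monoˡ-≤ n (m≤m+n a (toℕ k))))
    same-lift : _ → _ → a + toℕ i ≡ a + toℕ j
    same-lift (inj₁ (_ , vi≡a+i)) (inj₁ (_ , vj≡a+j)) = trans (sym vi≡a+i) (trans vi≡vj' vj≡a+j)
    same-lift (inj₂ vi+n≡a+i)     (inj₂ vj+n≡a+j)     = trans (sym vi+n≡a+i) (trans (cong (_+ n) vi≡vj') vj+n≡a+j)
    same-lift (inj₁ (_ , vi≡a+i)) (inj₂ vj+n≡a+j)     = contradiction (trans (cong (_+ n) vi≡vj') vj+n≡a+j) (lift-clash vi≡a+i)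
    same-lift (inj₂ vi+n≡a+i)     (inj₁ (_ , vj≡a+j)) = contradiction (trans (cong (_+ n) (sym vi≡vj')) vi+n≡a+i) (lift-clash vj≡a+j)

  rotatesBy⇒onto : Onto v
  rotatesBy⇒onto = injective⇒onto (lookup v) rotatesBy⇒injective

rotatesBy-unique : ∀ {a} {v w : Vec (Fin n) n} → RotatesBy a v → RotatesBy a w → v ≡ w
rotatesBy-unique {n} {a} {v} {w} rv rw = lookup-ext λ j → toℕ-injective (same (at rv j) (at rw j))
  where
  same : ∀ {j} → _ → _ → v ! j ≡ w ! j
  same (inj₁ (_ , e₁))    (inj₁ (_ , e₂)) = trans e₁ (sym e₂)
  same (inj₂ e₁)          (inj₂ e₂)       = +-cancelʳ-≡ n _ _ (trans e₁ (sym e₂))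
  same {j} (inj₁ (a+j<n , _)) (inj₂ e₂)   = contradiction (subst (n ≤_) e₂ (m≤n+m n (w ! j))) (<⇒≱ a+j<n)
  same {j} (inj₂ e₁) (inj₁ (a+j<n , _))   = contradiction (subst (n ≤_) e₁ (m≤n+m n (v ! j))) (<⇒≱ a+j<n)

rotations-coherent : ∀ {a b} {x y : Vec (Fin n) n} → RotatesBy a x → RotatesBy b y → Coherent (x !_) (y !_)
rotations-coherent rx ry i j xi<xj yi<yj with rotatesBy-gap rx i j xi<xj | rotatesBy-gap ry i j yi<yj
... | inj₁ (_ , gx)   | inj₁ (_ , gy)   = ≃-trans gy (≃-sym gx)
... | inj₂ (_ , gx)   | inj₂ (_ , gy)   = ≃-trans gy (≃-sym gx)
... | inj₁ (i<j , _) | inj₂ (j<i , _) = contradiction j<i (<-asym i<j)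
... | inj₂ (j<i , _) | inj₁ (i<j , _) = contradiction j<i (<-asym i<j)

rotation-coherentPerm : (a : Fin (suc m)) → CoherentPerm (rotation a)
rotation-coherentPerm a = coherentPerm (rotatesBy⇒onto (rotation-rotatesBy a)) (rotatesBy⇒coherent (rotation-rotatesBy a))

rotatesBy⇒rotation : ∀ {a} {v : Vec (Fin (suc m)) (suc m)} (a<n : a < suc m) → RotatesBy a v → v ≡ rotation (fromℕ< a<n)
rotatesBy⇒rotation a<n rv =
  rotatesBy-unique rv (subst (λ b → RotatesBy b (rotation (fromℕ< a<n))) (toℕ-fromℕ< a<n) (rotation-rotatesBy (fromℕ< a<n)))

identity-lookup : ∀ j → identity {m} ! j ≡ toℕ j
identity-lookup {m} j with rotation-lookup zero j
... | inj₁ (_ , e) = e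
... | inj₂ e       = contradiction (subst (suc m ≤_) e (m≤n+m (suc m) _)) (<⇒≱ (toℕ<n j))

pointwise⇒identity : {v : Vec (Fin (suc m)) (suc m)} → (∀ j → v ! j ≡ toℕ j) → v ≡ identity
pointwise⇒identity v≗id = lookup-ext λ j → toℕ-injective (trans (v≗id j) (sym (identity-lookup j)))

rotation-head : (a : Fin (suc m)) → rotation a ! zero ≡ toℕ a
rotation-head {m} a with rotation-lookup a zero
... | inj₁ (_ , e) = trans e (+-identityʳ _)
... | inj₂ e       = contradiction (subst (suc m ≤_) (trans e (+-identityʳ _)) (m≤n+m (suc m) _)) (<⇒≱ (toℕ<n a))

rotation-injective : Injective _≡_ _≡_ (rotation {m})
rotation-injective {x = a} {y = b} ra≡rb = toℕ-injective (trans (sym (rotation-head a)) (trans (cong (_! zero) ra≡rb) (rotation-head b)))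

entry≤max : (v : Vec (Fin (suc m)) (suc m)) (i : Fin (suc m)) → v ! i ≤ m
entry≤max v i = ≤-pred (toℕ<n (lookup v i))

module _ {v : Vec (Fin (suc m)) (suc m)} (perm : CoherentPerm v) where
  private
    coh = coherent perm
    injective = onto⇒injective v (onto perm)

  coherentPerm-injective : ∀ {i j} → v ! i ≡ v ! j → i ≡ j
  coherentPerm-injective vi≡vj = injective (toℕ-injective vi≡vj)

  below-max : ∀ {q j} → v ! q ≡ m → j ≢ q → v ! j < m
  below-max vq≡m j≢q = ≤∧≢⇒< (entry≤max v _) (λ vj≡m → j≢q (coherentPerm-injective (trans vj≡m (sym vq≡m))))

  rises-to-max : ∀ {q} → v ! q ≡ m → ∀ j → toℕ j ≤ toℕ q → m ⊖ v ! j ≃ toℕ q ⊖ toℕ j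
  rises-to-max {q} vq≡m j j≤q with j ≟ᶠ q
  ... | yes refl = subst (λ t → t ⊖ v ! j ≃ toℕ j ⊖ toℕ j) vq≡m (mk≃ refl)
  ... | no j≢q   = subst (λ t → t ⊖ v ! j ≃ toℕ q ⊖ toℕ j) vq≡m
    (coh j q (≤∧≢⇒< j≤q (j≢q ∘ toℕ-injective)) (subst (v ! j <_) (sym vq≡m) (below-max vq≡m j≢q)))

  rises-below-max : ∀ {q} → v ! q ≡ m → ∀ j k → toℕ j ≤ toℕ k → toℕ k ≤ toℕ q → v ! k ⊖ v ! j ≃ toℕ k ⊖ toℕ j
  rises-below-max vq≡m j k j≤k k≤q =
    ≃-subtractˡ (rises-to-max vq≡m j (≤-trans j≤k k≤q)) (rises-to-max vq≡m k k≤q)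

  above-head : ∀ j → v ! zero ≤ v ! j → v ! j ⊖ v ! zero ≃ toℕ j ⊖ 0
  above-head zero    _      = mk≃ refl
  above-head (suc j) v₀≤vj = coh zero (suc j) z<s (≤∧≢⇒< v₀≤vj (Fin.0≢1+n ∘ coherentPerm-injective))

  head-0⇒identity : v ! zero ≡ 0 → v ≡ identity
  head-0⇒identity v₀≡0 = pointwise⇒identity λ j →
    trans (sym (+-identityʳ _)) (trans (cross (above-head j (subst (_≤ v ! j) (sym v₀≡0) z≤n))) (cong (_+ toℕ j) v₀≡0))

identity-coherent : {f : Fin (suc m) → ℕ} → Coherent toℕ f → Coherent (identity !_) f
identity-coherent {f = f} coh i j idᵢ<idⱼ fi<fj =
  subst₂ (λ s t → f j ⊖ f i ≃ s ⊖ t) (sym (identity-lookup j)) (sym (identity-lookup i))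
    (coh i j (subst₂ _<_ (identity-lookup i) (identity-lookup j) idᵢ<idⱼ) fi<fj)

-- Classification of coherent pairs

IsRotation : Vec (Fin (suc m)) (suc m) → Set
IsRotation {m} v = ∃ λ a → v ≡ rotation {m} a

Classification : Vec (Fin (suc m)) (suc m) → Vec (Fin (suc m)) (suc m) → Set
Classification x y = x ≡ identity ⊎ y ≡ identity ⊎ x ≡ y ⊎ (IsRotation x × IsRotation y)

module Classify {m : ℕ} {x y : Vec (Fin (suc m)) (suc m)}
  (x-perm : CoherentPerm x) (y-perm : CoherentPerm y) (xy-coh : Coherent (x !_) (y !_))
  {k : Fin (suc m)} (xk≡m : x ! k ≡ m) (y-max-after : ∀ j → toℕ j < toℕ k → y ! j ≢ m) where

  private
    x-coh = coherent x-perm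
    y-coh = coherent y-perm
    β = y ! k

  x-below-max : ∀ {j} → j ≢ k → x ! j < x ! k
  x-below-max j≢k = subst (_ <_) (sym xk≡m) (below-max x-perm xk≡m j≢k)

  equal-max⇒equal : y ! k ≡ m → x ≡ y
  equal-max⇒equal yk≡m = lookup-ext λ j → toℕ-injective (same j)
    where
    same : ∀ j → x ! j ≡ y ! j
    same j with j ≟ᶠ k
    ... | yes refl = trans xk≡m (sym yk≡m)
    ... | no j≢k   = ≃-cancel-minuend (subst₂ (λ s t → s ⊖ y ! j ≃ t ⊖ x ! j) yk≡m xk≡m
                       (xy-coh j k (x-below-max j≢k) (subst (_ <_) (sym yk≡m) (below-max y-perm yk≡m j≢k))))

  module _ (β≢m : β ≢ m) where
    private
      q = proj₁ (positionOf y (onto y-perm) m (n<1+n m))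
      yq≡m : y ! q ≡ m
      yq≡m = proj₂ (positionOf y (onto y-perm) m (n<1+n m))

    k<q : toℕ k < toℕ q
    k<q with <-cmp (toℕ k) (toℕ q)
    ... | tri< k<q _ _ = k<q
    ... | tri≈ _ k≡q _ = contradiction (trans (cong (y !_) (toℕ-injective k≡q)) yq≡m) β≢m
    ... | tri> _ _ q<k = contradiction yq≡m (y-max-after q q<k)

    x-from-head : ∀ j → toℕ j ≤ toℕ k → x ! j ⊖ x ! zero ≃ toℕ j ⊖ 0
    x-from-head j j≤k = rises-below-max x-perm xk≡m zero j z≤n j≤k

    y-from-head : ∀ j → toℕ j ≤ toℕ k → y ! j ⊖ y ! zero ≃ toℕ j ⊖ 0
    y-from-head j j≤k = rises-below-max y-perm yq≡m zero j z≤n (≤-trans j≤k (<⇒≤ k<q))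

    β<m : β < m
    β<m = ≤∧≢⇒< (entry≤max y k) β≢m

    module _ (x₀≢0 : x ! zero ≢ 0) (y₀≢0 : y ! zero ≢ 0) where
      private
        after-k-≢ : ∀ {j} → toℕ k < toℕ j → j ≢ k
        after-k-≢ k<j refl = <-irrefl refl k<j

      above-β : ∀ j → toℕ k < toℕ j → β < y ! j → y ! j ⊖ β ≃ toℕ j ⊖ toℕ k
      above-β j k<j = y-coh k j k<j

      below-β : ∀ j → toℕ k < toℕ j → y ! j < β → β ⊖ y ! j ≃ m ⊖ x ! j
      below-β j k<j yj<β = subst (λ t → β ⊖ y ! j ≃ t ⊖ x ! j) xk≡m (xy-coh j k (x-below-max (after-k-≢ k<j)) yj<β)

      crossing-order : ∀ u l → toℕ k < toℕ l → β < y ! u → y ! l < β → toℕ u < toℕ l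
      crossing-order u l k<l β<yu yl<β with <-cmp (toℕ u) (toℕ l)
      ... | tri< u<l _ _ = u<l
      ... | tri≈ _ u≡l _ = contradiction (subst (λ i → y ! i < β) (sym (toℕ-injective u≡l)) yl<β) (<-asym β<yu)
      ... | tri> _ _ l<u = contradiction k<l (<-asym (≃-< (≃-sym β-above-yl) yl<β))
        where
        β-above-yl : β ⊖ y ! l ≃ toℕ k ⊖ toℕ l
        β-above-yl = ≃-subtractˡ (y-coh l u l<u (<-trans yl<β β<yu)) (above-β u (<-trans k<l l<u) β<yu)

      crossing-gap : ∀ u l → toℕ k < toℕ u → toℕ k < toℕ l → β < y ! u → y ! l < β → x ! l ⊖ x ! u ≃ toℕ l ⊖ toℕ u
      crossing-gap u l k<u k<l β<yu yl<β with <-cmp (x ! u) (x ! l)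
      ... | tri< xu<xl _ _ = x-coh u l (crossing-order u l k<l β<yu yl<β) xu<xl
      ... | tri≈ _ xu≡xl _ = contradiction (cong (y !_) (coherentPerm-injective x-perm xu≡xl)) λ yu≡yl →
                               <-asym β<yu (subst (_< β) (sym yu≡yl) yl<β)
      ... | tri> _ _ xl<xu = contradiction (entry≤max x u) (<⇒≱ (≃-< xu-above-m k<u))
        where
        xu-above-m : x ! u ⊖ m ≃ toℕ u ⊖ toℕ k
        xu-above-m = ≃-trans (≃-sym (≃-subtractʳ (xy-coh l u xl<xu (<-trans yl<β β<yu)) (below-β l k<l yl<β)))
                             (above-β u k<u β<yu)

      private
        l₀ = proj₁ (positionOf y (onto y-perm) 0 z<s)
        yl₀≡0 : y ! l₀ ≡ 0
        yl₀≡0 = proj₂ (positionOf y (onto y-perm) 0 z<s)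
        p₀ = proj₁ (positionOf x (onto x-perm) 0 z<s)
        xp₀≡0 : x ! p₀ ≡ 0
        xp₀≡0 = proj₂ (positionOf x (onto x-perm) 0 z<s)

      k<l₀ : toℕ k < toℕ l₀
      k<l₀ = ≰⇒> λ l₀≤k → y₀≢0 (n≤0⇒n≡0 (subst (y ! zero ≤_) yl₀≡0 (≃-≤ (y-from-head l₀ l₀≤k) z≤n)))

      k<p₀ : toℕ k < toℕ p₀
      k<p₀ = ≰⇒> λ p₀≤k → x₀≢0 (n≤0⇒n≡0 (subst (x ! zero ≤_) xp₀≡0 (≃-≤ (x-from-head p₀ p₀≤k) z≤n)))

      yl₀<β : y ! l₀ < β
      yl₀<β = subst (_< β) (sym yl₀≡0) (<-≤-trans (n≢0⇒n>0 y₀≢0) (≃-≤ (y-from-head k ≤-refl) z≤n))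

      β<yq : β < y ! q
      β<yq = subst (β <_) (sym yq≡m) β<m

      x-affine : ∀ j → toℕ k < toℕ j → x ! j ⊖ x ! q ≃ toℕ j ⊖ toℕ q
      x-affine j k<j with <-cmp (y ! j) β
      ... | tri< yj<β _ _ = crossing-gap q j k<q k<j β<yq yj<β
      ... | tri≈ _ yj≡β _ = contradiction (coherentPerm-injective y-perm yj≡β) (after-k-≢ k<j)
      ... | tri> _ _ β<yj = ≃-subtractˡ (crossing-gap q l₀ k<q k<l₀ β<yq yl₀<β) (crossing-gap j l₀ k<j k<l₀ β<yj yl₀<β)

      x-after-zero : ∀ j → toℕ k < toℕ j → x ! j ⊖ 0 ≃ toℕ j ⊖ toℕ p₀
      x-after-zero j k<j = subst (λ t → x ! j ⊖ t ≃ toℕ j ⊖ toℕ p₀) xp₀≡0 (≃-subtractʳ (x-affine j k<j) (x-affine p₀ k<p₀))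

      p₀≡1+k : toℕ p₀ ≡ suc (toℕ k)
      p₀≡1+k = ≤-antisym (subst (toℕ p₀ ≤_) (toℕ-fromℕ< 1+k<n) (≃-≤ (≃-sym (x-after-zero k' k<k')) z≤n)) k<p₀
        where
        1+k<n : suc (toℕ k) < suc m
        1+k<n = <-≤-trans (s≤s k<p₀) (toℕ<n p₀)
        k' = fromℕ< 1+k<n
        k<k' : toℕ k < toℕ k'
        k<k' = subst (toℕ k <_) (sym (toℕ-fromℕ< 1+k<n)) (n<1+n _)

      x-tail : ∀ j → toℕ k < toℕ j → x ! j ⊖ 0 ≃ toℕ j ⊖ suc (toℕ k)
      x-tail j k<j = subst (λ t → x ! j ⊖ 0 ≃ toℕ j ⊖ t) p₀≡1+k (x-after-zero j k<j)

      private
        x₀+k≡m : x ! zero + toℕ k ≡ m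
        x₀+k≡m = trans (sym (cross (x-from-head k ≤-refl))) (trans (+-identityʳ _) xk≡m)

        y₀+k≡β : y ! zero + toℕ k ≡ β
        y₀+k≡β = trans (sym (cross (y-from-head k ≤-refl))) (+-identityʳ _)

        head-offset : ∀ {v a j} → v ⊖ a ≃ j ⊖ 0 → v ≡ a + j
        head-offset gap = trans (sym (+-identityʳ _)) (cross gap)

        below-bound : ∀ {a} {j : Fin (suc m)} → a + toℕ k ≤ m → toℕ j ≤ toℕ k → a + toℕ j < suc m
        below-bound a+k≤m j≤k = s≤s (≤-trans (+-monoʳ-≤ _ j≤k) a+k≤m)

      x-rotates : RotatesBy (x ! zero) x
      x-rotates = rotates entry
        where
        entry : ∀ j → (x ! zero + toℕ j < suc m × x ! j ≡ x ! zero + toℕ j) ⊎ (x ! j + suc m ≡ x ! zero + toℕ j)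
        entry j with toℕ j ≤? toℕ k
        ... | yes j≤k = inj₁ (below-bound (≤-reflexive x₀+k≡m) j≤k , head-offset (x-from-head j j≤k))
        ... | no j≰k  = inj₂ (begin
          x ! j + suc m                  ≡⟨ cong (λ t → x ! j + suc t) x₀+k≡m ⟨
          x ! j + suc (x ! zero + toℕ k) ≡⟨ rearrange (x ! j) (x ! zero) (toℕ k) ⟩
          x ! zero + (x ! j + suc (toℕ k)) ≡⟨ cong (x ! zero +_) (cross (x-tail j (≰⇒> j≰k))) ⟩
          x ! zero + toℕ j               ∎)
          where
          open ≡-Reasoning
          rearrange : ∀ a b c → a + suc (b + c) ≡ b + (a + suc c)
          rearrange = solve-∀

      y-rotates : RotatesBy (y ! zero) y
      y-rotates = rotates entry
        where
        entry : ∀ j → (y ! zero + toℕ j < suc m × y ! j ≡ y ! zero + toℕ j) ⊎ (y ! j + suc m ≡ y ! zero + toℕ j)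
        entry j with toℕ j ≤? toℕ k
        ... | yes j≤k = inj₁ (below-bound (≤-trans (≤-reflexive y₀+k≡β) (<⇒≤ β<m)) j≤k , head-offset (y-from-head j j≤k))
        ... | no j≰k with <-cmp (y ! j) β
        ...   | tri≈ _ yj≡β _ = contradiction (coherentPerm-injective y-perm yj≡β) (after-k-≢ (≰⇒> j≰k))
        ...   | tri> _ _ β<yj = inj₁ (subst (_< suc m) yj≡ (toℕ<n (lookup y j)) , yj≡)
          where
          yj≡ : y ! j ≡ y ! zero + toℕ j
          yj≡ = head-offset (≃-telescope (above-β j (≰⇒> j≰k) β<yj) (y-from-head k ≤-refl))
        ...   | tri< yj<β _ _ = inj₂ (+-cancelʳ-≡ (toℕ k) _ _ (begin
          (y ! j + suc m) + toℕ k        ≡⟨ rearrange (y ! j) m (toℕ k) ⟩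
          (y ! j + m) + suc (toℕ k)      ≡⟨ cong (_+ suc (toℕ k)) (cross (below-β j (≰⇒> j≰k) yj<β)) ⟨
          (β + x ! j) + suc (toℕ k)      ≡⟨ +-assoc β (x ! j) (suc (toℕ k)) ⟩
          β + (x ! j + suc (toℕ k))      ≡⟨ cong (β +_) (cross (x-tail j (≰⇒> j≰k))) ⟩
          β + toℕ j                      ≡⟨ cong (_+ toℕ j) y₀+k≡β ⟨
          (y ! zero + toℕ k) + toℕ j     ≡⟨ +-comm-last (y ! zero) (toℕ k) (toℕ j) ⟩
          (y ! zero + toℕ j) + toℕ k     ∎))
          where
          open ≡-Reasoning
          rearrange : ∀ a b c → (a + suc b) + c ≡ (a + b) + suc c
          rearrange = solve-∀
          +-comm-last : ∀ a b c → (a + b) + c ≡ (a + c) + b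
          +-comm-last = solve-∀

      both-rotations : IsRotation x × IsRotation y
      both-rotations = (fromℕ< x₀<n , rotatesBy⇒rotation x₀<n x-rotates) , (fromℕ< y₀<n , rotatesBy⇒rotation y₀<n y-rotates)
        where
        x₀<n = s≤s (entry≤max x zero)
        y₀<n = s≤s (entry≤max y zero)

  classification : Classification x y
  classification with β ≟ m
  ... | yes β≡m = inj₂ (inj₂ (inj₁ (equal-max⇒equal β≡m)))
  ... | no β≢m with x ! zero ≟ 0 | y ! zero ≟ 0
  ...   | yes x₀≡0 | _        = inj₁ (head-0⇒identity x-perm x₀≡0)
  ...   | no _     | yes y₀≡0 = inj₂ (inj₁ (head-0⇒identity y-perm y₀≡0))
  ...   | no x₀≢0  | no y₀≢0  = inj₂ (inj₂ (inj₂ (both-rotations β≢m x₀≢0 y₀≢0)))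

classification-sym : {x y : Vec (Fin (suc m)) (suc m)} → Classification y x → Classification x y
classification-sym (inj₁ y≡id)                  = inj₂ (inj₁ y≡id)
classification-sym (inj₂ (inj₁ x≡id))           = inj₁ x≡id
classification-sym (inj₂ (inj₂ (inj₁ y≡x)))     = inj₂ (inj₂ (inj₁ (sym y≡x)))
classification-sym (inj₂ (inj₂ (inj₂ (ry , rx)))) = inj₂ (inj₂ (inj₂ (rx , ry)))

classify : {x y : Vec (Fin (suc m)) (suc m)} → CoherentPair x y → Classification x y
classify {m} {x} {y} (x-perm , y-perm , xy-coh)
  with p , xp≡m ← positionOf x (onto x-perm) m (n<1+n m)
     | q , yq≡m ← positionOf y (onto y-perm) m (n<1+n m)
  with toℕ p ≤? toℕ q
... | yes p≤q = Classify.classification x-perm y-perm xy-coh xp≡m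
                  λ j j<p yj≡m → <-irrefl (cong toℕ (coherentPerm-injective y-perm (trans yj≡m (sym yq≡m)))) (<-≤-trans j<p p≤q)
... | no p≰q  = classification-sym (Classify.classification y-perm x-perm (coherent-sym xy-coh) yq≡m
                  λ j j<q xj≡m → <-irrefl (cong toℕ (coherentPerm-injective x-perm (trans xj≡m (sym xp≡m)))) (<-trans j<q (≰⇒> p≰q)))

-- Enumeration and counting

toℕ-punchIn : (a : Fin (suc n)) (w : Fin n) →
  (toℕ w < toℕ a × toℕ (punchIn a w) ≡ toℕ w) ⊎ (toℕ a ≤ toℕ w × toℕ (punchIn a w) ≡ suc (toℕ w))
toℕ-punchIn zero    w       = inj₂ (z≤n , refl)
toℕ-punchIn (suc a) zero    = inj₁ (z<s , refl)
toℕ-punchIn (suc a) (suc w) with toℕ-punchIn a w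
... | inj₁ (w<a , e) = inj₁ (s≤s w<a , cong suc e)
... | inj₂ (a≤w , e) = inj₂ (s≤s a≤w , cong suc e)

extend : Fin (suc n) → Vec (Fin n) n → Vec (Fin (suc n)) (suc n)
extend a y = a ∷ Vec.map (punchIn a) y

extend-tail : (a : Fin (suc n)) (y : Vec (Fin n) n) (k : Fin n) →
  (y ! k < toℕ a × extend a y ! suc k ≡ y ! k) ⊎ (toℕ a ≤ y ! k × extend a y ! suc k ≡ suc (y ! k))
extend-tail a y k rewrite lookup-map k (punchIn a) y = toℕ-punchIn a (lookup y k)

module _ {m : ℕ} (a : Fin (suc (suc m))) {y : Vec (Fin (suc m)) (suc m)} (y-perm : CoherentPerm y)
         (a-top-or-head : toℕ a ≡ suc m ⊎ toℕ a ≡ y ! zero) where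
  private
    e = extend a y
    y-coh = coherent y-perm

    a-is-head : ∀ {l} → toℕ a ≤ y ! l → toℕ a ≡ y ! zero
    a-is-head {l} a≤yl = [ (λ a≡top → contradiction (subst (_≤ y ! l) a≡top a≤yl) (<⇒≱ (s≤s (entry≤max y l)))) , id ]′
                            a-top-or-head

    above-a : ∀ l → toℕ a ≤ y ! l → y ! l ⊖ toℕ a ≃ toℕ l ⊖ 0
    above-a l a≤yl = subst (λ t → y ! l ⊖ t ≃ toℕ l ⊖ 0) (sym (a-is-head a≤yl))
      (above-head y-perm l (subst (_≤ y ! l) (a-is-head a≤yl) a≤yl))

  extend-onto : Onto e
  extend-onto w with w ≟ᶠ a
  ... | yes refl = zero , refl
  ... | no w≢a   = let k , yk≡ = onto y-perm (punchOut (w≢a ∘ sym)) in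
    suc k , trans (lookup-map k (punchIn a) y) (trans (cong (punchIn a) yk≡) (punchIn-punchOut _))

  extend-coherent : Coherent toℕ (e !_)
  extend-coherent zero (suc l) _ a<el with extend-tail a y l
  ... | inj₁ (yl<a , el≡yl)   = contradiction (subst (toℕ a <_) el≡yl a<el) (<-asym yl<a)
  ... | inj₂ (a≤yl , el≡1+yl) = ≃-cong (sym el≡1+yl) refl (≃-swap (≃-sucˡ (≃-swap (above-a l a≤yl))))
  extend-coherent (suc k) (suc l) (s≤s k<l) ek<el with extend-tail a y k | extend-tail a y l
  ... | inj₁ (_ , ek≡yk) | inj₁ (_ , el≡yl) =
    ≃-cong (sym el≡yl) (sym ek≡yk) (≃-sucʳ (y-coh k l k<l (subst₂ _<_ ek≡yk el≡yl ek<el)))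
  ... | inj₂ (_ , ek≡1+yk) | inj₂ (_ , el≡1+yl) =
    ≃-cong (sym el≡1+yl) (sym ek≡1+yk) (≃-sucˡ (≃-sucʳ (y-coh k l k<l (≤-pred (subst₂ _<_ ek≡1+yk el≡1+yl ek<el)))))
  ... | inj₁ (yk<a , _) | inj₂ (a≤yl , _) = contradiction (≃-≤ (≃-subtractˡ (above-a l a≤yl) yl-above-yk) z≤n) (<⇒≱ yk<a)
    where
    yl-above-yk : y ! l ⊖ y ! k ≃ toℕ l ⊖ toℕ k
    yl-above-yk = y-coh k l k<l (<-≤-trans yk<a a≤yl)
  ... | inj₂ (a≤yk , ek≡1+yk) | inj₁ (yl<a , el≡yl) =
    contradiction (subst₂ _<_ ek≡1+yk el≡yl ek<el) (<-asym (<-≤-trans yl<a (≤-trans a≤yk (n≤1+n _))))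

  extend-coherentPerm : CoherentPerm e
  extend-coherentPerm = coherentPerm extend-onto extend-coherent

module _ {m : ℕ} {a : Fin (suc (suc m))} {xs : Vec (Fin (suc (suc m))) (suc m)} (x-perm : CoherentPerm (a ∷ xs)) where
  private
    x = a ∷ xs
    x-coh = coherent x-perm

    a∉xs : ∀ k → a ≢ lookup xs k
    a∉xs k a≡xsₖ = Fin.0≢1+n (coherentPerm-injective x-perm (cong toℕ a≡xsₖ))

  -- Opaque because unfolding the tabulation makes type checking blow up.
  opaque
    rest : Vec (Fin (suc m)) (suc m)
    rest = tabulate λ k → punchOut (a∉xs k)

    rest-lookup : ∀ k → lookup rest k ≡ punchOut (a∉xs k)
    rest-lookup = lookup∘tabulate (λ k → punchOut (a∉xs k))

  private
    xs-lookup : ∀ k → lookup xs k ≡ punchIn a (lookup rest k)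
    xs-lookup k = sym (trans (cong (punchIn a) (rest-lookup k)) (punchIn-punchOut (a∉xs k)))

  extend-rest : x ≡ extend a rest
  extend-rest = cong (a ∷_) (lookup-ext λ k → trans (xs-lookup k) (sym (lookup-map k (punchIn a) rest)))

  private
    tail : ∀ k → (rest ! k < toℕ a × x ! suc k ≡ rest ! k) ⊎ (toℕ a ≤ rest ! k × x ! suc k ≡ suc (rest ! k))
    tail k = subst (λ v → (rest ! k < toℕ a × v ! suc k ≡ rest ! k) ⊎ (toℕ a ≤ rest ! k × v ! suc k ≡ suc (rest ! k)))
               (sym extend-rest) (extend-tail a rest k)

  rest-onto : Onto rest
  rest-onto w with onto x-perm (punchIn a w)
  ... | zero  , a≡ = contradiction (sym a≡) (punchInᵢ≢i a w)
  ... | suc k , xsₖ≡ = k , trans (rest-lookup k) (trans (punchOut-cong a xsₖ≡) (punchOut-punchIn a))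

  rest-coherent : Coherent toℕ (rest !_)
  rest-coherent k l k<l rk<rl with tail k | tail l
  ... | inj₁ (_ , xk≡rk) | inj₁ (_ , xl≡rl) =
    ≃-sucʳ⁻ (≃-cong xl≡rl xk≡rk (x-coh (suc k) (suc l) (s≤s k<l) (subst₂ _<_ (sym xk≡rk) (sym xl≡rl) rk<rl)))
  ... | inj₂ (_ , xk≡1+rk) | inj₂ (_ , xl≡1+rl) =
    ≃-sucˡ⁻ (≃-sucʳ⁻ (≃-cong xl≡1+rl xk≡1+rk (x-coh (suc k) (suc l) (s≤s k<l) (subst₂ _<_ (sym xk≡1+rk) (sym xl≡1+rl) (s≤s rk<rl)))))
  ... | inj₁ (rk<a , xk≡rk) | inj₂ (a≤rl , xl≡1+rl) = contradiction (subst (toℕ a <_) xk≡rk a<xk) (<-asym rk<a)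
    where
    a<xl : toℕ a < x ! suc l
    a<xl = subst (toℕ a <_) (sym xl≡1+rl) (s≤s a≤rl)
    xk<xl : x ! suc k < x ! suc l
    xk<xl = subst₂ _<_ (sym xk≡rk) (sym xl≡1+rl) (<-trans rk<rl (n<1+n _))
    a<xk : toℕ a < x ! suc k
    a<xk = ≃-< (≃-subtractˡ (x-coh zero (suc l) z<s a<xl) (x-coh (suc k) (suc l) (s≤s k<l) xk<xl)) z<s
  ... | inj₂ (a≤rk , _) | inj₁ (rl<a , _) = contradiction (<-trans rk<rl rl<a) (≤⇒≯ a≤rk)

  rest-coherentPerm : CoherentPerm rest
  rest-coherentPerm = coherentPerm rest-onto rest-coherent

  second-follows-head : toℕ a < suc m → x ! suc zero ≡ suc (toℕ a)
  second-follows-head a<top with p , xp≡top ← positionOf x (onto x-perm) (suc m) (n<1+n _)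
    with p
  ... | zero  = contradiction xp≡top (<⇒≢ a<top)
  ... | suc p' = trans (sym (+-identityʳ _)) (trans (cross (rises-below-max x-perm xp≡top zero (suc zero) z≤n (s≤s z≤n))) (+-comm (toℕ a) 1))

  rest-head : toℕ a ≡ suc m ⊎ toℕ a ≡ rest ! zero
  rest-head with toℕ a ≟ suc m
  ... | yes a≡top = inj₁ a≡top
  ... | no a≢top with tail zero
  ...   | inj₁ (r₀<a , x₁≡r₀)   = contradiction (trans (sym x₁≡r₀) (second-follows-head a<top)) (<⇒≢ (<-trans r₀<a (n<1+n _)))
    where a<top = ≤∧≢⇒< (≤-pred (toℕ<n a)) a≢top
  ...   | inj₂ (_ , x₁≡1+r₀) = inj₂ (suc-injective (trans (sym (second-follows-head a<top)) x₁≡1+r₀))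
    where a<top = ≤∧≢⇒< (≤-pred (toℕ<n a)) a≢top

prependMax : Vec (Fin (suc m)) (suc m) → Vec (Fin (suc (suc m))) (suc (suc m))
prependMax {m} = extend (fromℕ (suc m))

prependHead : Vec (Fin (suc m)) (suc m) → Vec (Fin (suc (suc m))) (suc (suc m))
prependHead y = extend (inject₁ (lookup y zero)) y

-- The first entry of a coherent permutation is either its maximum or one less
-- than the second entry; deleting it leaves a coherent permutation.
coherentPerms : (m : ℕ) → List (Vec (Fin (suc m)) (suc m))
coherentPerms zero    = (zero ∷ []) ∷ []
coherentPerms (suc m) = List.map prependMax (coherentPerms m) ++ List.map prependHead (coherentPerms m)

coherentPerms-sound : ∀ m {v} → v ∈ coherentPerms m → CoherentPerm v
coherentPerms-sound zero (here refl) = coherentPerm (λ { zero → zero , refl }) (λ { zero zero () })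
coherentPerms-sound (suc m) v∈ with ∈-++⁻ (List.map prependMax (coherentPerms m)) v∈
... | inj₁ v∈₁ with y , y∈ , refl ← ∈-map⁻ prependMax v∈₁ =
  extend-coherentPerm _ (coherentPerms-sound m y∈) (inj₁ (toℕ-fromℕ (suc m)))
... | inj₂ v∈₂ with y , y∈ , refl ← ∈-map⁻ prependHead v∈₂ =
  extend-coherentPerm _ (coherentPerms-sound m y∈) (inj₂ (toℕ-inject₁ (lookup y zero)))

coherentPerms-complete : ∀ m {v} → CoherentPerm v → v ∈ coherentPerms m
coherentPerms-complete zero {zero ∷ []} _ = here refl
coherentPerms-complete (suc m) {a ∷ xs} perm with rest-head perm
... | inj₁ a≡top = subst (_∈ coherentPerms (suc m)) (sym (trans (extend-rest perm) (cong (λ b → extend b (rest perm)) a≡max)))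
    (∈-++⁺ˡ (∈-map⁺ prependMax (coherentPerms-complete m (rest-coherentPerm perm))))
  where a≡max = toℕ-injective (trans a≡top (sym (toℕ-fromℕ (suc m))))
... | inj₂ a≡r₀ = subst (_∈ coherentPerms (suc m)) (sym (trans (extend-rest perm) (cong (λ b → extend b (rest perm)) a≡head)))
    (∈-++⁺ʳ (List.map prependMax (coherentPerms m)) (∈-map⁺ prependHead (coherentPerms-complete m (rest-coherentPerm perm))))
  where a≡head = toℕ-injective (trans a≡r₀ (sym (toℕ-inject₁ (lookup (rest perm) zero))))

extend-injective : ∀ {a a' : Fin (suc n)} {y y'} → extend a y ≡ extend a' y' → y ≡ y'
extend-injective {a = a} {y = y} {y'} e≡e' with refl ← ∷-injectiveˡ e≡e' =
  lookup-ext λ k → punchIn-injective a _ _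
    (trans (sym (lookup-map k (punchIn a) y)) (trans (cong (λ v → lookup v k) (∷-injectiveʳ e≡e')) (lookup-map k (punchIn a) y')))

coherentPerms-unique : ∀ m → Unique (coherentPerms m)
coherentPerms-unique zero    = All.[] ∷ []
coherentPerms-unique (suc m) = Unique.++⁺ (Unique.map⁺ extend-injective (coherentPerms-unique m))
                                          (Unique.map⁺ extend-injective (coherentPerms-unique m)) heads-differ
  where
  heads-differ : Disjoint (List.map prependMax (coherentPerms m)) (List.map prependHead (coherentPerms m))
  heads-differ (v∈₁ , v∈₂) with _ , _ , v≡₁ ← ∈-map⁻ prependMax v∈₁ | _ , _ , v≡₂ ← ∈-map⁻ prependHead v∈₂ =
    fromℕ≢inject₁ (∷-injectiveˡ (trans (sym v≡₁) v≡₂))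

length-coherentPerms : ∀ m → List.length (coherentPerms m) ≡ 2 ^ m
length-coherentPerms zero    = refl
length-coherentPerms (suc m) = begin
  List.length (List.map prependMax (coherentPerms m) ++ List.map prependHead (coherentPerms m))
    ≡⟨ length-++ (List.map prependMax (coherentPerms m)) ⟩
  List.length (List.map prependMax (coherentPerms m)) + List.length (List.map prependHead (coherentPerms m))
    ≡⟨ cong₂ _+_ (length-map prependMax (coherentPerms m)) (length-map prependHead (coherentPerms m)) ⟩
  List.length (coherentPerms m) + List.length (coherentPerms m)
    ≡⟨ cong₂ _+_ (length-coherentPerms m) (trans (length-coherentPerms m) (sym (+-identityʳ (2 ^ m)))) ⟩
  2 ^ m + (2 ^ m + 0) ∎
  where open ≡-Reasoning

module Count (m : ℕ) where
  Perm : Set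
  Perm = Vec (Fin (suc m)) (suc m)

  isRotation? : (v : Perm) → Dec (v ≡ rotation (lookup v zero))
  isRotation? v = ≡-dec _≟ᶠ_ v (rotation (lookup v zero))

  rotation-isRotation : ∀ (a : Fin (suc m)) → rotation a ≡ rotation (lookup (rotation a) zero)
  rotation-isRotation a = cong rotation (toℕ-injective (sym (rotation-head a)))

  nonRotations : List Perm
  nonRotations = filter (¬? ∘ isRotation?) (coherentPerms m)

  rotations nonIdentityRotations : List Perm
  rotations            = List.map rotation (allFin (suc m))
  nonIdentityRotations = List.map (rotation ∘ suc) (allFin m)

  identity-then self-then-identity self-pair : Perm → Perm × Perm
  identity-then y     = identity , y
  self-then-identity x = x , identity
  self-pair x          = x , x

  identityFirst rotationPairs identitySecond diagonal pairs : List (Perm × Perm)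
  identityFirst  = List.map identity-then (coherentPerms m)
  rotationPairs  = cartesianProduct nonIdentityRotations rotations
  identitySecond = List.map self-then-identity nonRotations
  diagonal       = List.map self-pair nonRotations
  pairs          = identityFirst ++ rotationPairs ++ identitySecond ++ diagonal

  private
    identity-perm : CoherentPerm (identity {m})
    identity-perm = rotation-coherentPerm zero

    nonRotation : ∀ {x} → x ∈ nonRotations → CoherentPerm x × x ≢ rotation (lookup x zero)
    nonRotation x∈ = let x∈G , x-nonrot = ∈-filter⁻ (¬? ∘ isRotation?) x∈ in coherentPerms-sound m x∈G , x-nonrot

  pairs-sound : ∀ {x y} → (x , y) ∈ pairs → CoherentPair x y
  pairs-sound xy∈ with ∈-++⁻ identityFirst xy∈
  ... | inj₁ ∈₁ with _ , y∈ , refl ← ∈-map⁻ identity-then ∈₁ =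
    let y-perm = coherentPerms-sound m y∈ in identity-perm , y-perm , identity-coherent (coherent y-perm)
  ... | inj₂ ∈₂₃₄ with ∈-++⁻ rotationPairs ∈₂₃₄
  ... | inj₁ ∈₂ with x∈ , y∈ ← ∈-cartesianProduct⁻ nonIdentityRotations rotations ∈₂
    with a , _ , refl ← ∈-map⁻ (rotation ∘ suc) {xs = allFin m} x∈ | b , _ , refl ← ∈-map⁻ rotation {xs = allFin (suc m)} y∈ =
    rotation-coherentPerm (suc a) , rotation-coherentPerm b , rotations-coherent (rotation-rotatesBy (suc a)) (rotation-rotatesBy b)
  ... | inj₂ ∈₃₄ with ∈-++⁻ identitySecond ∈₃₄
  ... | inj₁ ∈₃ with _ , x∈ , refl ← ∈-map⁻ self-then-identity ∈₃ =
    let x-perm = proj₁ (nonRotation x∈) in x-perm , identity-perm , coherent-sym (identity-coherent (coherent x-perm))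
  ... | inj₂ ∈₄ with _ , x∈ , refl ← ∈-map⁻ self-pair ∈₄ =
    let x-perm = proj₁ (nonRotation x∈) in x-perm , x-perm , coherent-refl _

  private
    nonIdentityRotation∈ : ∀ a → rotation a ≢ identity → rotation a ∈ nonIdentityRotations
    nonIdentityRotation∈ zero    r≢id = contradiction refl r≢id
    nonIdentityRotation∈ (suc a) _    = ∈-map⁺ (rotation ∘ suc) (∈-allFin a)

    rotation-pair : ∀ {x y} → x ≢ identity → x ≡ rotation (lookup x zero) → IsRotation y → (x , y) ∈ rotationPairs
    rotation-pair {x} x≢id x-rot (b , refl) = ∈-cartesianProduct⁺
      (subst (_∈ nonIdentityRotations) (sym x-rot) (nonIdentityRotation∈ (lookup x zero) (x≢id ∘ trans x-rot)))
      (∈-map⁺ rotation (∈-allFin b))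

  pairs-complete : ∀ {x y} → CoherentPair x y → (x , y) ∈ pairs
  pairs-complete {x} {y} xy@(x-perm , y-perm , _) with ≡-dec _≟ᶠ_ x identity | isRotation? x
  ... | yes refl | _ = ∈-++⁺ˡ (∈-map⁺ identity-then (coherentPerms-complete m y-perm))
  ... | no x≢id | yes x-rot = ∈-++⁺ʳ identityFirst (∈-++⁺ˡ (rotation-pair x≢id x-rot y-rotation))
    where
    y-rotation : IsRotation y
    y-rotation with classify xy
    ... | inj₁ x≡id                  = contradiction x≡id x≢id
    ... | inj₂ (inj₁ y≡id)           = zero , y≡id
    ... | inj₂ (inj₂ (inj₁ x≡y))     = lookup x zero , trans (sym x≡y) x-rot
    ... | inj₂ (inj₂ (inj₂ (_ , y-rot))) = y-rot
  ... | no x≢id | no x-nonrot with classify xy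
  ...   | inj₁ x≡id = contradiction x≡id x≢id
  ...   | inj₂ (inj₁ refl) = ∈-++⁺ʳ identityFirst (∈-++⁺ʳ rotationPairs (∈-++⁺ˡ (∈-map⁺ self-then-identity x∈)))
    where x∈ = ∈-filter⁺ (¬? ∘ isRotation?) (coherentPerms-complete m x-perm) x-nonrot
  ...   | inj₂ (inj₂ (inj₁ refl)) = ∈-++⁺ʳ identityFirst (∈-++⁺ʳ rotationPairs (∈-++⁺ʳ identitySecond (∈-map⁺ self-pair x∈)))
    where x∈ = ∈-filter⁺ (¬? ∘ isRotation?) (coherentPerms-complete m x-perm) x-nonrot
  ...   | inj₂ (inj₂ (inj₂ ((a , refl) , _))) = contradiction (rotation-isRotation a) x-nonrot

  private
    identity-isRotation : identity ≡ rotation (lookup identity zero)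
    identity-isRotation = rotation-isRotation zero

    nonRotations-unique : Unique nonRotations
    nonRotations-unique = Unique.filter⁺ (¬? ∘ isRotation?) (coherentPerms-unique m)

    rotations-unique : Unique rotations
    rotations-unique = Unique.map⁺ rotation-injective (Unique.allFin⁺ (suc m))

    rotationPairs-first : ∀ {x y} → (x , y) ∈ rotationPairs → ∃ λ a → x ≡ rotation (suc a)
    rotationPairs-first ∈₂
      with a , _ , x≡ ← ∈-map⁻ (rotation ∘ suc) (proj₁ (∈-cartesianProduct⁻ nonIdentityRotations rotations ∈₂)) = a , x≡

    later-first : ∀ {x y} → (x , y) ∈ identitySecond ++ diagonal → x ≢ rotation (lookup x zero)
    later-first ∈₃₄ with ∈-++⁻ identitySecond ∈₃₄
    ... | inj₁ ∈₃ with _ , x∈ , refl ← ∈-map⁻ self-then-identity ∈₃ = proj₂ (nonRotation x∈)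
    ... | inj₂ ∈₄ with _ , x∈ , refl ← ∈-map⁻ self-pair ∈₄ = proj₂ (nonRotation x∈)

  pairs-unique : Unique pairs
  pairs-unique =
    Unique.++⁺ (Unique.map⁺ (cong proj₂) (coherentPerms-unique m))
      (Unique.++⁺ (Unique.cartesianProduct⁺ (Unique.map⁺ (Fin.suc-injective ∘ rotation-injective) (Unique.allFin⁺ m)) rotations-unique)
        (Unique.++⁺ (Unique.map⁺ (cong proj₁) nonRotations-unique) (Unique.map⁺ (cong proj₁) nonRotations-unique)
          second-third-disjoint)
        rotations-disjoint)
      identity-disjoint
    where
    second-third-disjoint : Disjoint identitySecond diagonal
    second-third-disjoint (∈₃ , ∈₄)
      with _ , _ , v≡x,id ← ∈-map⁻ self-then-identity ∈₃ | _ , x∈ , v≡x,x ← ∈-map⁻ self-pair ∈₄ =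
      proj₂ (nonRotation x∈) (subst (λ v → v ≡ rotation (lookup v zero)) (cong proj₂ (trans (sym v≡x,id) v≡x,x)) identity-isRotation)

    rotations-disjoint : Disjoint rotationPairs (identitySecond ++ diagonal)
    rotations-disjoint (∈₂ , ∈₃₄) with a , refl ← rotationPairs-first ∈₂ = later-first ∈₃₄ (rotation-isRotation (suc a))

    identity-disjoint : Disjoint identityFirst (rotationPairs ++ identitySecond ++ diagonal)
    identity-disjoint (∈₁ , ∈₂₃₄) with _ , _ , refl ← ∈-map⁻ identity-then ∈₁ | ∈-++⁻ rotationPairs ∈₂₃₄
    ... | inj₁ ∈₂  = let a , id≡ = rotationPairs-first ∈₂ in Fin.0≢1+n (rotation-injective id≡)
    ... | inj₂ ∈₃₄ = later-first ∈₃₄ identity-isRotation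

  private
    r = List.length nonRotations

    length-allFin : ∀ n → List.length (allFin n) ≡ n
    length-allFin n = length-tabulate id

    rotations-in-coherentPerms : ∀ {x} → x ∈ filter isRotation? (coherentPerms m) ⇔ x ∈ rotations
    rotations-in-coherentPerms {x} = mk⇔
      (λ x∈ → let _ , x-rot = ∈-filter⁻ isRotation? {xs = coherentPerms m} x∈ in
        subst (_∈ rotations) (sym x-rot) (∈-map⁺ rotation (∈-allFin (lookup x zero))))
      (λ x∈ → let a , _ , x≡ = ∈-map⁻ rotation {xs = allFin (suc m)} x∈ in
        subst (_∈ filter isRotation? (coherentPerms m)) (sym x≡)
          (∈-filter⁺ isRotation? (coherentPerms-complete m (rotation-coherentPerm a)) (rotation-isRotation a)))

  nonRotations-count : r + suc m ≡ 2 ^ m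
  nonRotations-count = begin
    r + suc m                                              ≡⟨ +-comm r (suc m) ⟩
    suc m + r                                              ≡⟨ cong (_+ r) rotation-count ⟨
    List.length (filter isRotation? (coherentPerms m)) + r ≡⟨ length-filter-split isRotation? (coherentPerms m) ⟩
    List.length (coherentPerms m)                          ≡⟨ length-coherentPerms m ⟩
    2 ^ m                                                  ∎
    where
    open ≡-Reasoning
    rotation-count : List.length (filter isRotation? (coherentPerms m)) ≡ suc m
    rotation-count = trans (unique-sameMembers⇒length≡ (Unique.filter⁺ isRotation? (coherentPerms-unique m)) rotations-unique rotations-in-coherentPerms)
                           (trans (length-map rotation (allFin (suc m))) (length-allFin (suc m)))

  length-pairs : List.length pairs ≡ 2 ^ m + (m * suc m + (r + r))
  length-pairs = begin
    List.length pairs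
      ≡⟨ length-++ identityFirst ⟩
    List.length identityFirst + List.length (rotationPairs ++ identitySecond ++ diagonal)
      ≡⟨ cong (List.length identityFirst +_) (length-++ rotationPairs) ⟩
    List.length identityFirst + (List.length rotationPairs + List.length (identitySecond ++ diagonal))
      ≡⟨ cong (λ t → List.length identityFirst + (List.length rotationPairs + t)) (length-++ identitySecond) ⟩
    List.length identityFirst + (List.length rotationPairs + (List.length identitySecond + List.length diagonal))
      ≡⟨ cong₂ (λ s t → s + (t + (List.length identitySecond + List.length diagonal)))
               (trans (length-map identity-then (coherentPerms m)) (length-coherentPerms m))
               (trans (length-cartesianProduct nonIdentityRotations rotations)
                      (cong₂ _*_ (trans (length-map (rotation ∘ suc) (allFin m)) (length-allFin m))
                                 (trans (length-map rotation (allFin (suc m))) (length-allFin (suc m))))) ⟩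
    2 ^ m + (m * suc m + (List.length identitySecond + List.length diagonal))
      ≡⟨ cong (λ t → 2 ^ m + (m * suc m + t)) (cong₂ _+_ (length-map self-then-identity nonRotations) (length-map self-pair nonRotations)) ⟩
    2 ^ m + (m * suc m + (r + r)) ∎
    where open ≡-Reasoning

  pairs-closed-form : List.length pairs + 2 * suc m ≡ 3 * 2 ^ m + m * suc m
  pairs-closed-form = begin
    List.length pairs + 2 * suc m                   ≡⟨ cong (_+ 2 * suc m) length-pairs ⟩
    2 ^ m + (m * suc m + (r + r)) + 2 * suc m       ≡⟨ cong (λ t → t + (m * suc m + (r + r)) + 2 * suc m) nonRotations-count ⟨
    (r + suc m) + (m * suc m + (r + r)) + 2 * suc m ≡⟨ rearrange r m ⟩
    3 * (r + suc m) + m * suc m                     ≡⟨ cong (λ t → 3 * t + m * suc m) nonRotations-count ⟩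
    3 * 2 ^ m + m * suc m                           ∎
    where
    open ≡-Reasoning
    rearrange : ∀ r m → (r + suc m) + (m * suc m + (r + r)) + 2 * suc m ≡ 3 * (r + suc m) + m * suc m
    rearrange = solve-∀

S²-↔-pairs : ∀ m → S²[132,213] (suc m) ↔ Fin (List.length (Count.pairs m))
S²-↔-pairs m = unique-enumeration-↔ (pairs m) (pairs-unique m)
  (λ { {σ , σ'} → mk⇔ (pairs-complete m ∘ S²-member⇒coherentPair σ σ') (coherentPair⇒S²-member σ σ' ∘ pairs-sound m) })
  (λ { {σ , σ'} → T-irrelevant })
  where open Count

theorem3p7 : (a : ℕ → ℕ) → (∀ n → n ≥ 1 → Fin (a n) ↔ S²[132,213] n) →
    (a 1 ≡ 1) × (∀ n → n ≥ 1 → a (suc n) ≡ a n + 3 * 2 ^ (n ∸ 1) + 2 * (n ∸ 1))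
theorem3p7 a count = a₁≡1 , recurrence
  where
  open ≡-Reasoning

  closed-form : ∀ m → a (suc m) + 2 * suc m ≡ 3 * 2 ^ m + m * suc m
  closed-form m = trans (cong (_+ 2 * suc m) (↔⇒≡ (S²-↔-pairs m ↔-∘ count (suc m) (s≤s z≤n)))) (Count.pairs-closed-form m)

  a₁≡1 : a 1 ≡ 1
  a₁≡1 = +-cancelʳ-≡ 2 (a 1) 1 (closed-form 0)

  recurrence : ∀ n → n ≥ 1 → a (suc n) ≡ a n + 3 * 2 ^ (n ∸ 1) + 2 * (n ∸ 1)
  recurrence (suc m) _ = +-cancelʳ-≡ (2 * suc (suc m)) _ _ (begin
    a (suc (suc m)) + 2 * suc (suc m)                 ≡⟨ closed-form (suc m) ⟩
    3 * 2 ^ suc m + suc m * suc (suc m)               ≡⟨ expand (2 ^ m) m ⟩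
    (3 * 2 ^ m + m * suc m) + 3 * 2 ^ m + 2 * m + 2   ≡⟨ cong (λ t → t + 3 * 2 ^ m + 2 * m + 2) (closed-form m) ⟨
    (a (suc m) + 2 * suc m) + 3 * 2 ^ m + 2 * m + 2   ≡⟨ regroup (a (suc m)) (2 ^ m) m ⟩
    a (suc m) + 3 * 2 ^ m + 2 * m + 2 * suc (suc m)   ∎)
    where
    expand : ∀ p m → 3 * (2 * p) + suc m * suc (suc m) ≡ (3 * p + m * suc m) + 3 * p + 2 * m + 2
    expand = solve-∀
    regroup : ∀ A p m → (A + 2 * suc m) + 3 * p + 2 * m + 2 ≡ A + 3 * p + 2 * m + 2 * suc (suc m)
    regroup = solve-∀
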